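{- Let $u\ge1$ and $d,d'\ge1$ be integers. Let $T=\{T_1,\dots,T_l\}\in L(d+u,d)$ and $T'=\{T'_1,\dots,T'_l\}\in L(d'+u,d')$ satisfy $\operatorname{codim}_d(T_i)=\operatorname{codim}_{d'}(T'_i)$ for each $i=1,\dots,l$. Define $\bar\mu_{u,d}(T)=\mu_{d+u,d}(T)$. Then $\bar\mu_{u,d}(T)=\bar\mu_{u,d'}(T')$.
   Context: For a finite set $X$ put $\operatorname{codim}_d(X)=d+1-|X|$. For a finite collection $\{T_1,\dots,T_l\}$ of pairwise distinct finite sets put $\rho_d(\{T_1,\dots,T_l\})=\sum_{i=1}^l\operatorname{codim}_d(T_i)$ (with $\rho_d(\emptyset)=0$) and $D_d(\{T_1,\dots,T_l\})=\operatorname{codim}_d(T_1\cap\cdots\cap T_l)-\rho_d(\{T_1,\dots,T_l\})$. For integers $d\ge1$, $n>d$, let $L(n,d)$ be the set of all $T\subset 2^{\{1,\dots,n\}}$ such that (1) $D_d(T')>0$ for every $T'\subset T$ with $|T'|>1$, and (2) $0\le |T_i|\le d$ for every $T_i\in T$. It is partially ordered by: $T<T'$ iff $\rho_d(T)<\rho_d(T')$ and for every $T_i\in T$ there exists $T'_j\in T'$ with $T'_j\subset T_i$; $T\le T'$ means $T<T'$ or $T=T'$. Its minimum is $\emptyset$. The Möbius function $\mu_{n,d}$ of $L(n,d)$ is defined by $\mu_{n,d}(T,T)=1$ and $\sum_{S:\,T\le S\le T'}\mu_{n,d}(T,S)=0$ for $T<T'$; one writes $\mu_{n,d}(T)=\mu_{n,d}(\emptyset,T)$.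 -}

module Defs where

open import Data.Bool using (Bool; true; false)
import Data.Bool.Properties as BoolP
open import Data.Nat as ℕ using (ℕ; zero; suc)
open import Data.Integer as ℤ using (ℤ; +_; _-_; -_)
import Data.Integer.Properties as ℤP
open import Data.Fin.Subset using (Subset; _∩_; ⊤; _⊆_; ∣_∣; inside; outside)
open import Data.Fin.Subset.Properties using (_⊆?_)
open import Data.List using (List; []; _∷_; map; _++_; foldr; length; filter)
import Data.List.Properties as ListP
import Data.Vec.Properties as VecP
open import Data.List.Relation.Unary.All using (All)
import Data.List.Relation.Unary.All as All
open import Data.List.Relation.Unary.Any using (Any)
import Data.List.Relation.Unary.Any as Any
open import Data.List.Membership.Propositional using (_∈_)
open import Data.Product using (Σ; _×_; _,_)
open import Data.Sum using (_⊎_)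
open import Relation.Nullary using (Dec; yes; no; ¬_)
open import Relation.Nullary.Decidable using (_×-dec_; _⊎-dec_; _→-dec_)
open import Relation.Binary.PropositionalEquality using (_≡_)
open import Relation.Binary.Definitions using (DecidableEquality)

-- Collections
-- are represented canonically as sublists of the fixed enumeration
-- 'allSubsets n' of all subsets of {1,…,n} (Subset n = Vec Bool n).
Coll : ℕ → Set
Coll n = List (Subset n)

allSubsets : (n : ℕ) → List (Subset n)
allSubsets zero    = Data.List.[ Data.Vec.[] ]
  where import Data.List ; import Data.Vec
allSubsets (suc n) = map (outside Data.Vec.∷_) (allSubsets n) ++ map (inside Data.Vec.∷_) (allSubsets n)
  where import Data.Vec

sublists : ∀ {A : Set} → List A → List (List A)
sublists []       = [] ∷ []
sublists (x ∷ xs) = sublists xs ++ map (x ∷_) (sublists xs)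

codim : ∀ {n} → ℕ → Subset n → ℤ
codim d X = + (suc d) - + ∣ X ∣

ρ : ∀ {n} → ℕ → Coll n → ℤ
ρ d T = foldr (λ X r → codim d X ℤ.+ r) (+ 0) T

-- T_1 ∩ ⋯ ∩ T_l  (only used for l ≥ 2)
⋂ : ∀ {n} → Coll n → Subset n
⋂ {n} T = foldr _∩_ ⊤ T

D : ∀ {n} → ℕ → Coll n → ℤ
D d T = codim d (⋂ T) - ρ d T

-- Membership condition for L(n,d):
-- (1) D_d(T') > 0 for every subcollection T' ⊆ T with |T'| > 1,
-- (2) 0 ≤ |T_i| ≤ d for every T_i ∈ T.
IsL : ∀ {n} → ℕ → Coll n → Set
IsL d T = All (λ S → 2 ℕ.≤ length S → + 0 ℤ.< D d S) (sublists T)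
        × All (λ X → ∣ X ∣ ℕ.≤ d) T

isL? : ∀ {n} (d : ℕ) (T : Coll n) → Dec (IsL d T)
isL? d T = All.all? (λ S → (2 ℕ.≤? length S) →-dec (+ 0 ℤ.<? D d S)) (sublists T)
           ×-dec All.all? (λ X → ∣ X ∣ ℕ.≤? d) T

-- L(n,d) as an explicit finite list (each collection appears exactly once)
L : (n d : ℕ) → List (Coll n)
L n d = filter (isL? d) (sublists (allSubsets n))

_<[_]_ : ∀ {n} → Coll n → ℕ → Coll n → Set
T <[ d ] T' = (ρ d T ℤ.< ρ d T') × All (λ X → Any (λ Y → Y ⊆ X) T') T

<? : ∀ {n} (d : ℕ) (T T' : Coll n) → Dec (T <[ d ] T')
<? d T T' = (ρ d T ℤ.<? ρ d T') ×-dec All.all? (λ X → Any.any? (λ Y → Y ⊆? X) T') T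

_≟C_ : ∀ {n} → DecidableEquality (Coll n)
_≟C_ = ListP.≡-dec (VecP.≡-dec BoolP._≟_)

_≤[_]_ : ∀ {n} → Coll n → ℕ → Coll n → Set
T ≤[ d ] T' = T <[ d ] T' ⊎ T ≡ T'

≤? : ∀ {n} (d : ℕ) (T T' : Coll n) → Dec (T ≤[ d ] T')
≤? d T T' = <? d T T' ⊎-dec (T ≟C T')

sumℤ : List ℤ → ℤ
sumℤ = foldr ℤ._+_ (+ 0)

-- The fuel argument only ensures structural
-- termination; fuel 1 + |L(n,d)| exceeds the length of every chain.
mobiusFuel : (n d : ℕ) → ℕ → Coll n → Coll n → ℤ
mobiusFuel n d zero    T T' = + 0
mobiusFuel n d (suc k) T T' with T ≟C T'
... | yes _ = + 1
... | no _ with <? d T T'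
...   | no _  = + 0
...   | yes _ = - sumℤ (map (mobiusFuel n d k T)
                  (filter (λ S → ≤? d T S ×-dec <? d S T') (L n d)))

μ₂ : (n d : ℕ) → Coll n → Coll n → ℤ
μ₂ n d T T' = mobiusFuel n d (suc (length (L n d))) T T'

μ : (n d : ℕ) → Coll n → ℤ
μ n d T = μ₂ n d [] T

μ̄ : (u d : ℕ) → Coll (d ℕ.+ u) → ℤ
μ̄ u d T = μ (d ℕ.+ u) d T

module Submission where

-- μ(∅,T) only depends on the interval [∅,T], so it suffices to give an
-- order isomorphism [∅,T] ≅ [∅,T′] (IntervalIso, μ-iso).  Pair T_i with T′_i.
-- In {1,…,d+u}, |∁T_i| = codim(T_i) + u - 1, so ∁T_i and ∁T′_i have the
-- same size, and moving the points outside T_i in order onto those outside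
-- T′_i is a bijection {Z ⊇ T_i} → {Z ⊇ T′_i} preserving ∩, ⊆ and codim
-- (transplant).  A set of size ≤ d contains at most one T_i, since
-- D_d({T_i,T_j}) > 0 forces |T_i ∪ T_j| > d + 1, so these bijections glue
-- to one map σ (glue).  Applied memberwise, σ preserves ρ, the covering
-- order, and condition (1) of L, the latter by superadditivity of D over
-- the groups of a collection (Grouping).  The reversed pairs give the
-- inverse map (OneWay, paired-interval-iso).

open import Defs
open import Function using (_∘_; id)
open import Function.Bundles using (mk⇔)
open import Data.Bool using (true; false; _∧_)
open import Data.Nat as ℕ using (ℕ; zero; suc; z≤n; s≤s)
import Data.Nat.Properties as ℕP
open import Data.Integer as ℤ using (ℤ; +_; -_; _-_; _+_)
import Data.Integer.Properties as ℤP
open import Data.Integer.Tactic.RingSolver using (solve-∀)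
open import Data.Vec using ([]; _∷_)
import Data.Vec as Vec
import Data.Vec.Properties as VecP
open import Data.Fin.Subset using (Subset; _∩_; _∪_; ∁; ⊤; ⊥; _⊆_; _∈_; ∣_∣; inside; outside)
import Data.Fin.Subset.Properties as SubP
open import Data.List using (List; []; _∷_; map; filter; length; _++_; foldr)
import Data.List.Properties as ListP
import Data.List.Membership.Propositional as ListMem
open import Data.List.Membership.Propositional.Properties using (∈-filter⁻; ∈-filter⁺; ∈-map⁺; ∈-map⁻; ∈-++⁻; ∈-++⁺ˡ; ∈-++⁺ʳ)
open import Data.List.Membership.Propositional.Properties.WithK using (unique∧set⇒bag)
open import Data.List.Relation.Unary.Any using (Any; here; there)
import Data.List.Relation.Unary.Any as Any
open import Data.List.Relation.Unary.All using (All; []; _∷_)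
import Data.List.Relation.Unary.All as All
open import Data.List.Relation.Unary.Unique.Propositional using (Unique)
open import Data.List.Relation.Unary.AllPairs using ([]; _∷_)
import Data.List.Relation.Unary.Unique.Propositional.Properties as UniqueP
open import Data.List.Relation.Binary.Permutation.Propositional using (_↭_; prep; ↭-sym; ↭-refl; ↭-trans; ↭-reflexive; ↭⇒↭ₛ)
import Data.List.Relation.Binary.Permutation.Propositional as Perm
import Data.List.Relation.Binary.Permutation.Setoid.Properties as PermS
open import Algebra.Structures using (IsCommutativeMonoid)
import Data.List.Relation.Binary.Permutation.Propositional.Properties as PermP
open import Data.List.Relation.Binary.BagAndSetEquality using (∼bag⇒↭)
open import Data.List.Relation.Binary.Sublist.Propositional using ([]; _∷_; _∷ʳ_) renaming (_⊆_ to _⊑_)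
import Data.List.Relation.Binary.Sublist.Propositional as Sublist
import Data.List.Relation.Binary.Sublist.Propositional.Properties as SublistP
import Data.Product.Properties as ProdP
import Data.Bool.Properties as BoolP
open import Relation.Binary.Definitions using (DecidableEquality)
import Data.List.Relation.Unary.Any.Properties as AnyP
import Data.List.Relation.Unary.All.Properties as AllP
open import Data.List.Relation.Binary.Pointwise using (Pointwise; []; _∷_)
open import Data.Product using (Σ; _×_; _,_; proj₁; proj₂; swap)
open import Data.Sum using (_⊎_; inj₁; inj₂)
open import Data.Empty using (⊥-elim)
open import Relation.Nullary using (Dec; yes; no; ¬_; ¬?; _×-dec_)
open import Relation.Unary using (Decidable; Pred)
open import Relation.Binary.PropositionalEquality

open ListMem using () renaming (_∈_ to _∈ₗ_)

sumℤ-cong : ∀ {A : Set} (f g : A → ℤ) (xs : List A) → (∀ {x} → x ∈ₗ xs → f x ≡ g x) →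
            sumℤ (map f xs) ≡ sumℤ (map g xs)
sumℤ-cong f g []       f≗g = refl
sumℤ-cong f g (x ∷ xs) f≗g = cong₂ _+_ (f≗g (here refl)) (sumℤ-cong f g xs (f≗g ∘ there))

foldr-↭ : ∀ {A : Set} {_∙_ : A → A → A} {ε : A} → IsCommutativeMonoid _≡_ _∙_ ε →
          ∀ {xs ys} → xs ↭ ys → foldr _∙_ ε xs ≡ foldr _∙_ ε ys
foldr-↭ {A} isCM xs↭ys = PermS.foldr-commMonoid (setoid A) isCM (↭⇒↭ₛ xs↭ys)

sumℤ-↭ : ∀ {xs ys : List ℤ} → xs ↭ ys → sumℤ xs ≡ sumℤ ys
sumℤ-↭ = foldr-↭ ℤP.+-0-isCommutativeMonoid

same-members⇒↭ : ∀ {A : Set} {xs ys : List A} → Unique xs → Unique ys →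
                 (∀ {z} → z ∈ₗ xs → z ∈ₗ ys) → (∀ {z} → z ∈ₗ ys → z ∈ₗ xs) → xs ↭ ys
same-members⇒↭ uxs uys to from = ∼bag⇒↭ (unique∧set⇒bag uxs uys (mk⇔ to from))

module _ {A : Set} {P Q : Pred A Agda.Primitive.lzero} (P? : Decidable P) (Q? : Decidable Q)
         (P⇒Q : ∀ {x} → P x → Q x) where

  filter-length-≤ : ∀ xs → length (filter P? xs) ℕ.≤ length (filter Q? xs)
  filter-length-≤ [] = z≤n
  filter-length-≤ (x ∷ xs) with P? x | Q? x
  ... | yes _ | yes _ = s≤s (filter-length-≤ xs)
  ... | yes p | no ¬q = ⊥-elim (¬q (P⇒Q p))
  ... | no _  | yes _ = ℕP.m≤n⇒m≤1+n (filter-length-≤ xs)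
  ... | no _  | no _  = filter-length-≤ xs

  filter-length-< : ∀ {xs y} → y ∈ₗ xs → Q y → ¬ P y →
                    length (filter P? xs) ℕ.< length (filter Q? xs)
  filter-length-< {x ∷ xs} (here refl) qy ¬py with P? x | Q? x
  ... | yes py | _     = ⊥-elim (¬py py)
  ... | no _   | yes _ = s≤s (filter-length-≤ xs)
  ... | no _   | no ¬q = ⊥-elim (¬q qy)
  filter-length-< {x ∷ xs} (there y∈xs) qy ¬py with P? x | Q? x
  ... | yes _ | yes _ = s≤s (filter-length-< y∈xs qy ¬py)
  ... | yes p | no ¬q = ⊥-elim (¬q (P⇒Q p))
  ... | no _  | yes _ = ℕP.m≤n⇒m≤1+n (filter-length-< y∈xs qy ¬py)
  ... | no _  | no _  = filter-length-< y∈xs qy ¬py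

Covered : ∀ {n} → Coll n → Coll n → Set
Covered T T′ = All (λ X → Any (λ Y → Y ⊆ X) T′) T

covered-trans : ∀ {n} {A B C : Coll n} → Covered A B → Covered B C → Covered A C
covered-trans {n} {C = C} covAB covBC = All.map (λ X⊇B → through X⊇B covBC) covAB
  where
  through : ∀ {X : Subset n} {B′} → Any (λ Y → Y ⊆ X) B′ → Covered B′ C → Any (λ Z → Z ⊆ X) C
  through (here Y⊆X) (Y⊇C ∷ _) = Any.map (λ {_} Z⊆Y {_} x∈Z → Y⊆X (Z⊆Y x∈Z)) Y⊇C
  through (there X⊇B) (_ ∷ covBC) = through X⊇B covBC

<-trans : ∀ {n d} {A B C : Coll n} → A <[ d ] B → B <[ d ] C → A <[ d ] C
<-trans (ρ< , covAB) (ρ<′ , covBC) = ℤP.<-trans ρ< ρ<′ , covered-trans covAB covBC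

<-irrefl : ∀ {n d} {A : Coll n} → ¬ (A <[ d ] A)
<-irrefl (ρ< , _) = ℤP.<-irrefl refl ρ<

<-≤-trans : ∀ {n d} {A B C : Coll n} → A <[ d ] B → B ≤[ d ] C → A <[ d ] C
<-≤-trans A<B (inj₁ B<C)  = <-trans A<B B<C
<-≤-trans A<B (inj₂ refl) = A<B

module Recursion (n d : ℕ) where

  interval : Coll n → Coll n → List (Coll n)
  interval A B = filter (λ S → ≤? d A S ×-dec <? d S B) (L n d)

  interval⁻ : ∀ {A B S} → S ∈ₗ interval A B → S ∈ₗ L n d × A ≤[ d ] S × S <[ d ] B
  interval⁻ {A} {B} = ∈-filter⁻ (λ S → ≤? d A S ×-dec <? d S B) {xs = L n d}

  mobius-diagonal : ∀ k A → mobiusFuel n d (suc k) A A ≡ + 1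
  mobius-diagonal k A with A ≟C A
  ... | yes _  = refl
  ... | no A≢A = ⊥-elim (A≢A refl)

  mobius-off : ∀ k A B → A ≢ B → ¬ (A <[ d ] B) → mobiusFuel n d (suc k) A B ≡ + 0
  mobius-off k A B A≢B A≮B with A ≟C B
  ... | yes A≡B = ⊥-elim (A≢B A≡B)
  ... | no _ with <? d A B
  ...   | yes A<B = ⊥-elim (A≮B A<B)
  ...   | no _    = refl

  mobius-step : ∀ k A B → A ≢ B → A <[ d ] B →
                mobiusFuel n d (suc k) A B ≡ - sumℤ (map (mobiusFuel n d k A) (interval A B))
  mobius-step k A B A≢B A<B with A ≟C B
  ... | yes A≡B = ⊥-elim (A≢B A≡B)
  ... | no _ with <? d A B
  ...   | yes _   = refl
  ...   | no A≮B  = ⊥-elim (A≮B A<B)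

  interval-shrinks : ∀ {A B S} → S ∈ₗ interval A B → length (interval A S) ℕ.< length (interval A B)
  interval-shrinks {A} {B} {S} S∈ with interval⁻ S∈
  ... | S∈L , A≤S , S<B =
    filter-length-< (λ V → ≤? d A V ×-dec <? d V S) (λ V → ≤? d A V ×-dec <? d V B)
      (λ (A≤V , V<S) → A≤V , <-trans V<S S<B) S∈L (A≤S , S<B) (λ (_ , S<S) → <-irrefl S<S)

  mobiusFuel-stable : ∀ k k′ A B → length (interval A B) ℕ.< k → k ℕ.≤ k′ →
                      mobiusFuel n d k A B ≡ mobiusFuel n d k′ A B
  mobiusFuel-stable (suc j) (suc j′) A B len<k (s≤s j≤j′) with A ≟C B
  ... | yes _ = refl
  ... | no _ with <? d A B
  ...   | no _  = refl
  ...   | yes _ = cong -_ (sumℤ-cong _ _ (interval A B) (λ {S} S∈ →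
          mobiusFuel-stable j j′ A S (ℕP.<-≤-trans (interval-shrinks S∈) (ℕP.≤-pred len<k)) j≤j′))

  μ-fuel : ∀ k T → suc (length (L n d)) ℕ.≤ k → μ n d T ≡ mobiusFuel n d k [] T
  μ-fuel k T = mobiusFuel-stable (suc (length (L n d))) k [] T
                 (s≤s (ListP.length-filter (λ S → ≤? d [] S ×-dec <? d S T) (L n d)))

module _ {A : Set} where

  ∈-sublists⇒⊑ : ∀ (xs : List A) {v} → v ∈ₗ sublists xs → v ⊑ xs
  ∈-sublists⇒⊑ []       (here refl) = []
  ∈-sublists⇒⊑ (x ∷ xs) v∈ with ∈-++⁻ (sublists xs) v∈
  ... | inj₁ v∈skip = x ∷ʳ ∈-sublists⇒⊑ xs v∈skip
  ... | inj₂ v∈keep with ∈-map⁻ (x ∷_) v∈keep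
  ...   | w , w∈ , refl = refl ∷ ∈-sublists⇒⊑ xs w∈

  ⊑⇒∈-sublists : ∀ {xs v : List A} → v ⊑ xs → v ∈ₗ sublists xs
  ⊑⇒∈-sublists []               = here refl
  ⊑⇒∈-sublists (x ∷ʳ v⊑xs)      = ∈-++⁺ˡ (⊑⇒∈-sublists v⊑xs)
  ⊑⇒∈-sublists {x ∷ xs} (refl ∷ v⊑xs) = ∈-++⁺ʳ (sublists xs) (∈-map⁺ (x ∷_) (⊑⇒∈-sublists v⊑xs))

  unique-sublists : ∀ {xs : List A} → Unique xs → Unique (sublists xs)
  unique-sublists {[]}     _          = [] ∷ []
  unique-sublists {x ∷ xs} (x∉ ∷ uxs) =
    UniqueP.++⁺ (unique-sublists uxs) (UniqueP.map⁺ ListP.∷-injectiveʳ (unique-sublists uxs)) disjoint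
    where
    disjoint : ∀ {v} → ¬ (v ∈ₗ sublists xs × v ∈ₗ map (x ∷_) (sublists xs))
    disjoint (v∈skip , v∈keep) with ∈-map⁻ (x ∷_) v∈keep
    ... | w , _ , refl = All.lookup x∉ (Sublist.lookup (∈-sublists⇒⊑ xs v∈skip) (here refl)) refl

  unique-⊑ : ∀ {xs ys : List A} → Unique ys → xs ⊑ ys → Unique xs
  unique-⊑ u             []             = u
  unique-⊑ (_ ∷ uys)     (_ ∷ʳ xs⊑ys)   = unique-⊑ uys xs⊑ys
  unique-⊑ (y∉ ∷ uys)    (refl ∷ xs⊑ys) = SublistP.All-resp-⊆ xs⊑ys y∉ ∷ unique-⊑ uys xs⊑ys

  ⊑-↭ : ∀ {xs ys : List A} → xs ↭ ys → ∀ {Q} → Q ⊑ xs → Σ (List A) (λ Q′ → Q′ ⊑ ys × Q ↭ Q′)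
  ⊑-↭ Perm.refl Q⊑ = _ , Q⊑ , ↭-refl
  ⊑-↭ (prep x p) (_ ∷ʳ Q⊑) with ⊑-↭ p Q⊑
  ... | Q′ , Q′⊑ , r = Q′ , x ∷ʳ Q′⊑ , r
  ⊑-↭ (prep x p) (refl ∷ Q⊑) with ⊑-↭ p Q⊑
  ... | Q′ , Q′⊑ , r = x ∷ Q′ , refl ∷ Q′⊑ , prep x r
  ⊑-↭ (Perm.swap x y p) (_ ∷ʳ (_ ∷ʳ Q⊑)) with ⊑-↭ p Q⊑
  ... | Q′ , Q′⊑ , r = Q′ , y ∷ʳ (x ∷ʳ Q′⊑) , r
  ⊑-↭ (Perm.swap x y p) (_ ∷ʳ (refl ∷ Q⊑)) with ⊑-↭ p Q⊑
  ... | Q′ , Q′⊑ , r = y ∷ Q′ , refl ∷ (x ∷ʳ Q′⊑) , prep y r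
  ⊑-↭ (Perm.swap x y p) (refl ∷ (_ ∷ʳ Q⊑)) with ⊑-↭ p Q⊑
  ... | Q′ , Q′⊑ , r = x ∷ Q′ , y ∷ʳ (refl ∷ Q′⊑) , prep x r
  ⊑-↭ (Perm.swap x y p) (refl ∷ (refl ∷ Q⊑)) with ⊑-↭ p Q⊑
  ... | Q′ , Q′⊑ , r = y ∷ x ∷ Q′ , refl ∷ (refl ∷ Q′⊑) , Perm.swap x y r
  ⊑-↭ (Perm.trans p q) Q⊑ with ⊑-↭ p Q⊑
  ... | Q′ , Q′⊑ , r with ⊑-↭ q Q′⊑
  ...   | Q″ , Q″⊑ , r′ = Q″ , Q″⊑ , ↭-trans r r′

  pair-⊑ : ∀ {xs : List A} {x y} → x ∈ₗ xs → y ∈ₗ xs → x ≢ y →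
           (x ∷ y ∷ []) ⊑ xs ⊎ (y ∷ x ∷ []) ⊑ xs
  pair-⊑ (here refl)  (here refl)  x≢y = ⊥-elim (x≢y refl)
  pair-⊑ (here refl)  (there y∈)   _   = inj₁ (refl ∷ Sublist.from∈ y∈)
  pair-⊑ (there x∈)   (here refl)  _   = inj₂ (refl ∷ Sublist.from∈ x∈)
  pair-⊑ (there x∈)   (there y∈)   x≢y with pair-⊑ x∈ y∈ x≢y
  ... | inj₁ xy⊑ = inj₁ (_ ∷ʳ xy⊑)
  ... | inj₂ yx⊑ = inj₂ (_ ∷ʳ yx⊑)

⊑-map⁻ : ∀ {A B : Set} (f : A → B) {xs : List A} {Q} → Q ⊑ map f xs →
         Σ (List A) (λ Q₀ → Q₀ ⊑ xs × Q ≡ map f Q₀)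
⊑-map⁻ f {[]}     []           = [] , [] , refl
⊑-map⁻ f {x ∷ xs} (_ ∷ʳ Q⊑)    with ⊑-map⁻ f Q⊑
... | Q₀ , Q₀⊑ , refl = Q₀ , x ∷ʳ Q₀⊑ , refl
⊑-map⁻ f {x ∷ xs} (refl ∷ Q⊑)  with ⊑-map⁻ f Q⊑
... | Q₀ , Q₀⊑ , refl = x ∷ Q₀ , refl ∷ Q₀⊑ , refl

unique-allSubsets : ∀ n → Unique (allSubsets n)
unique-allSubsets zero    = [] ∷ []
unique-allSubsets (suc n) =
  UniqueP.++⁺ (UniqueP.map⁺ VecP.∷-injectiveʳ (unique-allSubsets n))
              (UniqueP.map⁺ VecP.∷-injectiveʳ (unique-allSubsets n)) disjoint
  where
  disjoint : ∀ {v} → ¬ (v ∈ₗ map (outside ∷_) (allSubsets n) × v ∈ₗ map (inside ∷_) (allSubsets n))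
  disjoint (v∈out , v∈in) with ∈-map⁻ (outside ∷_) v∈out | ∈-map⁻ (inside ∷_) v∈in
  ... | _ , _ , refl | _ , _ , ()

allSubsets-complete : ∀ n (Z : Subset n) → Z ∈ₗ allSubsets n
allSubsets-complete zero    []          = here refl
allSubsets-complete (suc n) (false ∷ Z) = ∈-++⁺ˡ (∈-map⁺ (outside ∷_) (allSubsets-complete n Z))
allSubsets-complete (suc n) (true ∷ Z)  =
  ∈-++⁺ʳ (map (outside ∷_) (allSubsets n)) (∈-map⁺ (inside ∷_) (allSubsets-complete n Z))

unique-L : ∀ n d → Unique (L n d)
unique-L n d = UniqueP.filter⁺ (isL? d) (unique-sublists (unique-allSubsets n))

L⁻ : ∀ {n d} {S : Coll n} → S ∈ₗ L n d → S ∈ₗ sublists (allSubsets n) × IsL d S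
L⁻ {n} {d} S∈L = ∈-filter⁻ (isL? d) {xs = sublists (allSubsets n)} S∈L

unique-map : ∀ {A B : Set} (f : A → B) (P : A → Set) →
             (∀ {a b} → P a → P b → f a ≡ f b → a ≡ b) →
             ∀ {xs} → All P xs → Unique xs → Unique (map f xs)
unique-map f P inj {[]}     _          _          = []
unique-map f P inj {x ∷ xs} (px ∷ pxs) (x∉ ∷ uxs) = image-fresh pxs x∉ ∷ unique-map f P inj pxs uxs
  where
  image-fresh : ∀ {ys} → All P ys → All (λ y → x ≢ y) ys → All (λ y → f x ≢ y) (map f ys)
  image-fresh []         []           = []
  image-fresh (py ∷ pys) (x≢y ∷ x≢ys) = (x≢y ∘ inj px py) ∷ image-fresh pys x≢ys

Below : (n d : ℕ) → Coll n → Coll n → Set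
Below n d T S = S ∈ₗ L n d × S ≤[ d ] T

record IntervalIso (n d n′ d′ : ℕ) (T : Coll n) (T′ : Coll n′) : Set where
  field
    to         : Coll n → Coll n′
    from       : Coll n′ → Coll n
    to-below   : ∀ {S} → Below n d T S → Below n′ d′ T′ (to S)
    from-below : ∀ {S} → Below n′ d′ T′ S → Below n d T (from S)
    from-to    : ∀ {S} → Below n d T S → from (to S) ≡ S
    to-from    : ∀ {S} → Below n′ d′ T′ S → to (from S) ≡ S
    to-<       : ∀ {S₁ S₂} → Below n d T S₁ → Below n d T S₂ → S₁ <[ d ] S₂ → to S₁ <[ d′ ] to S₂
    from-<     : ∀ {S₁ S₂} → Below n′ d′ T′ S₁ → Below n′ d′ T′ S₂ → S₁ <[ d′ ] S₂ → from S₁ <[ d ] from S₂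
    top∈L      : T ∈ₗ L n d
    ∅-below    : Below n d T []
    to-∅       : to [] ≡ []
    to-top     : to T ≡ T′

module _ {n d n′ d′} {T : Coll n} {T′ : Coll n′} (iso : IntervalIso n d n′ d′ T T′) where

  open IntervalIso iso
  open Recursion n d using (interval; interval⁻; mobius-diagonal; mobius-off; mobius-step)
  open Recursion n′ d′ using () renaming (interval to interval′; interval⁻ to interval′⁻;
    mobius-diagonal to mobius-diagonal′; mobius-off to mobius-off′; mobius-step to mobius-step′)

  private
    from-∅ : from [] ≡ []
    from-∅ = trans (cong from (sym to-∅)) (from-to ∅-below)

    ∅-below′ : Below n′ d′ T′ []
    ∅-below′ = subst (Below n′ d′ T′) to-∅ (to-below ∅-below)

    to-injective : ∀ {A B} → Below n d T A → Below n d T B → to A ≡ to B → A ≡ B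
    to-injective A≤ B≤ eq = trans (sym (from-to A≤)) (trans (cong from eq) (from-to B≤))

    interval-below : ∀ {S V} → Below n d T S → V ∈ₗ interval [] S → Below n d T V
    interval-below (_ , S≤T) V∈ with interval⁻ V∈
    ... | V∈L , _ , V<S = V∈L , inj₁ (<-≤-trans V<S S≤T)

    to-∅≤ : ∀ {S} → Below n d T S → [] ≤[ d ] S → [] ≤[ d′ ] to S
    to-∅≤ {S} S≤ (inj₁ ∅<S) = inj₁ (subst (λ z → z <[ d′ ] to S) to-∅ (to-< ∅-below S≤ ∅<S))
    to-∅≤ _  (inj₂ refl)    = inj₂ (sym to-∅)

    from-∅≤ : ∀ {S} → Below n′ d′ T′ S → [] ≤[ d′ ] S → [] ≤[ d ] from S
    from-∅≤ {S} S≤ (inj₁ ∅<S) = inj₁ (subst (λ z → z <[ d ] from S) from-∅ (from-< ∅-below′ S≤ ∅<S))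
    from-∅≤ _  (inj₂ refl)    = inj₂ (sym from-∅)

    to-interval : ∀ {S} → Below n d T S → map to (interval [] S) ↭ interval′ [] (to S)
    to-interval {S} S≤ =
      same-members⇒↭ (unique-map to (Below n d T) to-injective (All.tabulate (interval-below S≤))
                                 (UniqueP.filter⁺ _ (unique-L n d)))
                     (UniqueP.filter⁺ _ (unique-L n′ d′)) image⊆ image⊇
      where
      image⊆ : ∀ {Y} → Y ∈ₗ map to (interval [] S) → Y ∈ₗ interval′ [] (to S)
      image⊆ Y∈ with ∈-map⁻ to Y∈
      ... | V , V∈ , refl with interval⁻ V∈ | interval-below S≤ V∈
      ...   | _ , ∅≤V , V<S | V≤ = ∈-filter⁺ _ (proj₁ (to-below V≤)) (to-∅≤ V≤ ∅≤V , to-< V≤ S≤ V<S)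
      image⊇ : ∀ {Y} → Y ∈ₗ interval′ [] (to S) → Y ∈ₗ map to (interval [] S)
      image⊇ {Y} Y∈ with interval′⁻ Y∈
      ... | Y∈L , ∅≤Y , Y<toS = subst (_∈ₗ map to (interval [] S)) (to-from Y≤)
            (∈-map⁺ to (∈-filter⁺ _ (proj₁ (from-below Y≤))
              (from-∅≤ Y≤ ∅≤Y , subst (λ z → from Y <[ d ] z) (from-to S≤) (from-< Y≤ (to-below S≤) Y<toS))))
        where
        Y≤ : Below n′ d′ T′ Y
        Y≤ = Y∈L , inj₁ (<-≤-trans Y<toS (proj₂ (to-below S≤)))

  mobiusFuel-iso : ∀ k S → Below n d T S → mobiusFuel n d k [] S ≡ mobiusFuel n′ d′ k [] (to S)
  mobiusFuel-iso zero    S S≤ = refl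
  mobiusFuel-iso (suc k) S S≤ = by-cases ([] ≟C S) (<? d [] S)
    where
    open ≡-Reasoning
    ∅≢toS : [] ≢ S → [] ≢ to S
    ∅≢toS ∅≢S eq = ∅≢S (to-injective ∅-below S≤ (trans to-∅ eq))

    by-cases : Dec ([] ≡ S) → Dec ([] <[ d ] S) →
               mobiusFuel n d (suc k) [] S ≡ mobiusFuel n′ d′ (suc k) [] (to S)
    by-cases (yes refl) _ = begin
      mobiusFuel n d (suc k) [] []          ≡⟨ mobius-diagonal k [] ⟩
      + 1                                   ≡⟨ mobius-diagonal′ k [] ⟨
      mobiusFuel n′ d′ (suc k) [] []        ≡⟨ cong (mobiusFuel n′ d′ (suc k) []) to-∅ ⟨
      mobiusFuel n′ d′ (suc k) [] (to [])   ∎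
    by-cases (no ∅≢S) (yes ∅<S) = begin
      mobiusFuel n d (suc k) [] S
        ≡⟨ mobius-step k [] S ∅≢S ∅<S ⟩
      - sumℤ (map (mobiusFuel n d k []) (interval [] S))
        ≡⟨ cong -_ (sumℤ-cong _ _ (interval [] S) (λ V∈ → mobiusFuel-iso k _ (interval-below S≤ V∈))) ⟩
      - sumℤ (map (mobiusFuel n′ d′ k [] ∘ to) (interval [] S))
        ≡⟨ cong (-_ ∘ sumℤ) (ListP.map-∘ (interval [] S)) ⟩
      - sumℤ (map (mobiusFuel n′ d′ k []) (map to (interval [] S)))
        ≡⟨ cong -_ (sumℤ-↭ (PermP.map⁺ _ (to-interval S≤))) ⟩
      - sumℤ (map (mobiusFuel n′ d′ k []) (interval′ [] (to S)))
        ≡⟨ mobius-step′ k [] (to S) (∅≢toS ∅≢S) ∅<toS ⟨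
      mobiusFuel n′ d′ (suc k) [] (to S) ∎
      where
      ∅<toS : [] <[ d′ ] to S
      ∅<toS = subst (λ z → z <[ d′ ] to S) to-∅ (to-< ∅-below S≤ ∅<S)
    by-cases (no ∅≢S) (no ∅≮S) =
      trans (mobius-off k [] S ∅≢S ∅≮S) (sym (mobius-off′ k [] (to S) (∅≢toS ∅≢S) ∅≮toS))
      where
      ∅≮toS : ¬ ([] <[ d′ ] to S)
      ∅≮toS ∅<toS = ∅≮S (subst₂ (λ a b → a <[ d ] b) from-∅ (from-to S≤) (from-< ∅-below′ (to-below S≤) ∅<toS))

  μ-iso : μ n d T ≡ μ n′ d′ T′
  μ-iso = begin
    μ n d T                    ≡⟨ Recursion.μ-fuel n d K T (ℕP.m≤m+n _ _) ⟩
    mobiusFuel n d K [] T      ≡⟨ mobiusFuel-iso K T (top∈L , inj₂ refl) ⟩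
    mobiusFuel n′ d′ K [] (to T) ≡⟨ cong (mobiusFuel n′ d′ K []) to-top ⟩
    mobiusFuel n′ d′ K [] T′   ≡⟨ Recursion.μ-fuel n′ d′ K T′ (ℕP.m≤n+m _ (suc (length (L n d)))) ⟨
    μ n′ d′ T′                 ∎
    where
    open ≡-Reasoning
    K = suc (length (L n d)) ℕ.+ suc (length (L n′ d′))

∣p∩q∣+∣p∪q∣ : ∀ {n} (p q : Subset n) → ∣ p ∩ q ∣ ℕ.+ ∣ p ∪ q ∣ ≡ ∣ p ∣ ℕ.+ ∣ q ∣
∣p∩q∣+∣p∪q∣ []          []          = refl
∣p∩q∣+∣p∪q∣ (true ∷ p)  (true ∷ q)  = cong suc (begin
  ∣ p ∩ q ∣ ℕ.+ suc ∣ p ∪ q ∣   ≡⟨ ℕP.+-suc _ _ ⟩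
  suc (∣ p ∩ q ∣ ℕ.+ ∣ p ∪ q ∣) ≡⟨ cong suc (∣p∩q∣+∣p∪q∣ p q) ⟩
  suc (∣ p ∣ ℕ.+ ∣ q ∣)         ≡⟨ ℕP.+-suc _ _ ⟨
  ∣ p ∣ ℕ.+ suc ∣ q ∣           ∎)
  where open ≡-Reasoning
∣p∩q∣+∣p∪q∣ (true ∷ p)  (false ∷ q) = trans (ℕP.+-suc _ _) (cong suc (∣p∩q∣+∣p∪q∣ p q))
∣p∩q∣+∣p∪q∣ (false ∷ p) (true ∷ q)  =
  trans (ℕP.+-suc _ _) (trans (cong suc (∣p∩q∣+∣p∪q∣ p q)) (sym (ℕP.+-suc _ _)))
∣p∩q∣+∣p∪q∣ (false ∷ p) (false ∷ q) = ∣p∩q∣+∣p∪q∣ p q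

∣p∣+∣∁p∣≡n : ∀ {n} (p : Subset n) → ∣ p ∣ ℕ.+ ∣ ∁ p ∣ ≡ n
∣p∣+∣∁p∣≡n p = trans (cong (∣ p ∣ ℕ.+_) (SubP.∣∁p∣≡n∸∣p∣ p)) (ℕP.m+[n∸m]≡n (SubP.∣p∣≤n p))

⊆⇒∩≡ : ∀ {n} {p q : Subset n} → p ⊆ q → p ∩ q ≡ p
⊆⇒∩≡ {p = p} {q} p⊆q = SubP.⊆-antisym (SubP.p∩q⊆p p q) (λ x∈p → SubP.x∈p∩q⁺ (x∈p , p⊆q x∈p))

∩≡⇒⊆ : ∀ {n} {p q : Subset n} → p ∩ q ≡ p → p ⊆ q
∩≡⇒⊆ {p = p} {q} eq x∈p = SubP.p∩q⊆q p q (subst (_ ∈_) (sym eq) x∈p)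

∪-mono : ∀ {n} {p q p′ q′ : Subset n} → p ⊆ p′ → q ⊆ q′ → p ∪ q ⊆ p′ ∪ q′
∪-mono {p = p} {q} p⊆p′ q⊆q′ x∈ with SubP.x∈p∪q⁻ p q x∈
... | inj₁ x∈p = SubP.x∈p∪q⁺ (inj₁ (p⊆p′ x∈p))
... | inj₂ x∈q = SubP.x∈p∪q⁺ (inj₂ (q⊆q′ x∈q))

∪-least : ∀ {n} {p q r : Subset n} → p ⊆ r → q ⊆ r → p ∪ q ⊆ r
∪-least {p = p} {q} p⊆r q⊆r x∈ with SubP.x∈p∪q⁻ p q x∈
... | inj₁ x∈p = p⊆r x∈p
... | inj₂ x∈q = q⊆r x∈q

∩-mono : ∀ {n} {p q p′ q′ : Subset n} → p ⊆ p′ → q ⊆ q′ → p ∩ q ⊆ p′ ∩ q′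
∩-mono {p = p} {q} p⊆p′ q⊆q′ x∈ with SubP.x∈p∩q⁻ p q x∈
... | x∈p , x∈q = SubP.x∈p∩q⁺ (p⊆p′ x∈p , q⊆q′ x∈q)

-- For C ⊆ {1..n}, 'restrict C Z' lists the
-- bits of Z at the positions of C (a subset of {1..|C|}) and 'extend C'
-- puts such bits back at the positions of C.  'resize m′' reads a bit
-- vector at length m′ (truncating or padding with 'false'), which is the
-- identity when the lengths agree but needs no proof that they do.

restrict : ∀ {n} (C : Subset n) → Subset n → Subset ∣ C ∣
restrict []          []      = []
restrict (true ∷ C)  (b ∷ Z) = b ∷ restrict C Z
restrict (false ∷ C) (b ∷ Z) = restrict C Z

extend : ∀ {n} (C : Subset n) → Subset ∣ C ∣ → Subset n
extend []          a       = []
extend (true ∷ C)  (b ∷ a) = b ∷ extend C a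
extend (false ∷ C) a       = false ∷ extend C a

resize : ∀ {m} (m′ : ℕ) → Subset m → Subset m′
resize zero     _       = []
resize (suc m′) []      = false ∷ resize m′ []
resize (suc m′) (b ∷ v) = b ∷ resize m′ v

restrict-∩ : ∀ {n} (C A B : Subset n) → restrict C (A ∩ B) ≡ restrict C A ∩ restrict C B
restrict-∩ []          []      []      = refl
restrict-∩ (true ∷ C)  (a ∷ A) (b ∷ B) = cong (a ∧ b ∷_) (restrict-∩ C A B)
restrict-∩ (false ∷ C) (_ ∷ A) (_ ∷ B) = restrict-∩ C A B

restrict-⊤ : ∀ {n} (C : Subset n) → restrict C ⊤ ≡ ⊤
restrict-⊤ []          = refl
restrict-⊤ (true ∷ C)  = cong (true ∷_) (restrict-⊤ C)
restrict-⊤ (false ∷ C) = restrict-⊤ C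

restrict-∁-self : ∀ {n} (X : Subset n) → restrict (∁ X) X ≡ ⊥
restrict-∁-self []          = refl
restrict-∁-self (true ∷ X)  = restrict-∁-self X
restrict-∁-self (false ∷ X) = cong (false ∷_) (restrict-∁-self X)

∣restrict-∁∣ : ∀ {n} (X Z : Subset n) → X ⊆ Z → ∣ Z ∣ ≡ ∣ X ∣ ℕ.+ ∣ restrict (∁ X) Z ∣
∣restrict-∁∣ []          []          X⊆Z = refl
∣restrict-∁∣ (true ∷ X)  (c ∷ Z)     X⊆Z with X⊆Z Vec.here
... | Vec.here = cong suc (∣restrict-∁∣ X Z (SubP.drop-∷-⊆ X⊆Z))
∣restrict-∁∣ (false ∷ X) (true ∷ Z)  X⊆Z =
  trans (cong suc (∣restrict-∁∣ X Z (SubP.drop-∷-⊆ X⊆Z))) (sym (ℕP.+-suc _ _))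
∣restrict-∁∣ (false ∷ X) (false ∷ Z) X⊆Z = ∣restrict-∁∣ X Z (SubP.drop-∷-⊆ X⊆Z)

∪-extend-restrict : ∀ {n} (X Z : Subset n) → X ⊆ Z → X ∪ extend (∁ X) (restrict (∁ X) Z) ≡ Z
∪-extend-restrict []          []      X⊆Z = refl
∪-extend-restrict (true ∷ X)  (c ∷ Z) X⊆Z with X⊆Z Vec.here
... | Vec.here = cong (true ∷_) (∪-extend-restrict X Z (SubP.drop-∷-⊆ X⊆Z))
∪-extend-restrict (false ∷ X) (c ∷ Z) X⊆Z = cong (c ∷_) (∪-extend-restrict X Z (SubP.drop-∷-⊆ X⊆Z))

restrict-∪-extend : ∀ {n} (Y : Subset n) (a : Subset ∣ ∁ Y ∣) → restrict (∁ Y) (Y ∪ extend (∁ Y) a) ≡ a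
restrict-∪-extend []          []      = refl
restrict-∪-extend (true ∷ Y)  a       = restrict-∪-extend Y a
restrict-∪-extend (false ∷ Y) (b ∷ a) = cong (b ∷_) (restrict-∪-extend Y a)

∣∪-extend∣ : ∀ {n} (Y : Subset n) (a : Subset ∣ ∁ Y ∣) → ∣ Y ∪ extend (∁ Y) a ∣ ≡ ∣ Y ∣ ℕ.+ ∣ a ∣
∣∪-extend∣ []          []          = refl
∣∪-extend∣ (true ∷ Y)  a           = cong suc (∣∪-extend∣ Y a)
∣∪-extend∣ (false ∷ Y) (true ∷ a)  = trans (cong suc (∣∪-extend∣ Y a)) (sym (ℕP.+-suc _ _))
∣∪-extend∣ (false ∷ Y) (false ∷ a) = ∣∪-extend∣ Y a

extend-∩ : ∀ {n} (C : Subset n) (a b : Subset ∣ C ∣) → extend C (a ∩ b) ≡ extend C a ∩ extend C b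
extend-∩ []          a       b       = refl
extend-∩ (true ∷ C)  (x ∷ a) (y ∷ b) = cong (x ∧ y ∷_) (extend-∩ C a b)
extend-∩ (false ∷ C) a       b       = cong (false ∷_) (extend-∩ C a b)

extend-⊤ : ∀ {n} (C : Subset n) → extend C ⊤ ≡ C
extend-⊤ []          = refl
extend-⊤ (true ∷ C)  = cong (true ∷_) (extend-⊤ C)
extend-⊤ (false ∷ C) = cong (false ∷_) (extend-⊤ C)

extend-⊥ : ∀ {n} (C : Subset n) → extend C ⊥ ≡ ⊥
extend-⊥ []          = refl
extend-⊥ (true ∷ C)  = cong (false ∷_) (extend-⊥ C)
extend-⊥ (false ∷ C) = cong (false ∷_) (extend-⊥ C)

resize-id : ∀ {m} (v : Subset m) → resize m v ≡ v
resize-id []      = refl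
resize-id (b ∷ v) = cong (b ∷_) (resize-id v)

resize-∩ : ∀ {m} m′ (a b : Subset m) → resize m′ (a ∩ b) ≡ resize m′ a ∩ resize m′ b
resize-∩ zero     a       b       = refl
resize-∩ (suc m′) []      []      = cong (false ∷_) (resize-∩ m′ [] [])
resize-∩ (suc m′) (x ∷ a) (y ∷ b) = cong (x ∧ y ∷_) (resize-∩ m′ a b)

resize-⊥ : ∀ {m} m′ → resize m′ (⊥ {m}) ≡ ⊥
resize-⊥ zero              = refl
resize-⊥ {zero}  (suc m′) = cong (false ∷_) (resize-⊥ m′)
resize-⊥ {suc m} (suc m′) = cong (false ∷_) (resize-⊥ m′)

module _ {m m′ : ℕ} (m≡m′ : m ≡ m′) where

  resize-⊤ : resize m′ (⊤ {m}) ≡ ⊤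
  resize-⊤ rewrite m≡m′ = resize-id ⊤

  resize-inverse : (v : Subset m) → resize m (resize m′ v) ≡ v
  resize-inverse v rewrite m≡m′ = trans (cong (resize _) (resize-id v)) (resize-id v)

  ∣resize∣ : (v : Subset m) → ∣ resize m′ v ∣ ≡ ∣ v ∣
  ∣resize∣ v rewrite m≡m′ = cong ∣_∣ (resize-id v)

-- transplant X Y sends Z ⊇ X to Y together with the points of Z outside X,
-- moved in order to the points outside Y.
transplant : ∀ {n n′} → Subset n → Subset n′ → Subset n → Subset n′
transplant X Y Z = Y ∪ extend (∁ Y) (resize ∣ ∁ Y ∣ (restrict (∁ X) Z))

module Transplant {n n′} (X : Subset n) (Y : Subset n′) where

  ⊆-transplant : ∀ Z → Y ⊆ transplant X Y Z
  ⊆-transplant Z = SubP.p⊆p∪q _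

  transplant-∩ : ∀ Z W → transplant X Y (Z ∩ W) ≡ transplant X Y Z ∩ transplant X Y W
  transplant-∩ Z W = begin
    Y ∪ extend (∁ Y) (resize ∣ ∁ Y ∣ (restrict (∁ X) (Z ∩ W)))
      ≡⟨ cong (λ v → Y ∪ extend (∁ Y) (resize ∣ ∁ Y ∣ v)) (restrict-∩ (∁ X) Z W) ⟩
    Y ∪ extend (∁ Y) (resize ∣ ∁ Y ∣ (restrict (∁ X) Z ∩ restrict (∁ X) W))
      ≡⟨ cong (λ v → Y ∪ extend (∁ Y) v) (resize-∩ ∣ ∁ Y ∣ _ _) ⟩
    Y ∪ extend (∁ Y) ((resize ∣ ∁ Y ∣ (restrict (∁ X) Z)) ∩ (resize ∣ ∁ Y ∣ (restrict (∁ X) W)))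
      ≡⟨ cong (Y ∪_) (extend-∩ (∁ Y) _ _) ⟩
    Y ∪ (extend (∁ Y) _ ∩ extend (∁ Y) _)
      ≡⟨ SubP.∪-distribˡ-∩ Y _ _ ⟩
    transplant X Y Z ∩ transplant X Y W ∎
    where open ≡-Reasoning

  transplant-mono : ∀ {Z W} → Z ⊆ W → transplant X Y Z ⊆ transplant X Y W
  transplant-mono {Z} {W} Z⊆W = ∩≡⇒⊆ (trans (sym (transplant-∩ Z W)) (cong (transplant X Y) (⊆⇒∩≡ Z⊆W)))

  transplant-self : transplant X Y X ≡ Y
  transplant-self = begin
    Y ∪ extend (∁ Y) (resize ∣ ∁ Y ∣ (restrict (∁ X) X)) ≡⟨ cong (λ v → Y ∪ extend (∁ Y) (resize ∣ ∁ Y ∣ v)) (restrict-∁-self X) ⟩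
    Y ∪ extend (∁ Y) (resize ∣ ∁ Y ∣ ⊥)                  ≡⟨ cong (λ v → Y ∪ extend (∁ Y) v) (resize-⊥ _) ⟩
    Y ∪ extend (∁ Y) ⊥                                   ≡⟨ cong (Y ∪_) (extend-⊥ (∁ Y)) ⟩
    Y ∪ ⊥                                                ≡⟨ SubP.∪-identityʳ Y ⟩
    Y                                                    ∎
    where open ≡-Reasoning

  module _ (∣∁X∣≡∣∁Y∣ : ∣ ∁ X ∣ ≡ ∣ ∁ Y ∣) where

    transplant-⊤ : transplant X Y ⊤ ≡ ⊤
    transplant-⊤ = begin
      Y ∪ extend (∁ Y) (resize ∣ ∁ Y ∣ (restrict (∁ X) ⊤)) ≡⟨ cong (λ v → Y ∪ extend (∁ Y) (resize ∣ ∁ Y ∣ v)) (restrict-⊤ (∁ X)) ⟩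
      Y ∪ extend (∁ Y) (resize ∣ ∁ Y ∣ ⊤)                  ≡⟨ cong (λ v → Y ∪ extend (∁ Y) v) (resize-⊤ ∣∁X∣≡∣∁Y∣) ⟩
      Y ∪ extend (∁ Y) ⊤                                   ≡⟨ cong (Y ∪_) (extend-⊤ (∁ Y)) ⟩
      Y ∪ ∁ Y                                              ≡⟨ SubP.p∪∁p≡⊤ Y ⟩
      ⊤                                                    ∎
      where open ≡-Reasoning

    transplant-inverse : ∀ Z → X ⊆ Z → transplant Y X (transplant X Y Z) ≡ Z
    transplant-inverse Z X⊆Z = begin
      X ∪ extend (∁ X) (resize ∣ ∁ X ∣ (restrict (∁ Y) (transplant X Y Z)))
        ≡⟨ cong (λ v → X ∪ extend (∁ X) (resize ∣ ∁ X ∣ v)) (restrict-∪-extend Y _) ⟩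
      X ∪ extend (∁ X) (resize ∣ ∁ X ∣ (resize ∣ ∁ Y ∣ (restrict (∁ X) Z)))
        ≡⟨ cong (λ v → X ∪ extend (∁ X) v) (resize-inverse ∣∁X∣≡∣∁Y∣ (restrict (∁ X) Z)) ⟩
      X ∪ extend (∁ X) (restrict (∁ X) Z)
        ≡⟨ ∪-extend-restrict X Z X⊆Z ⟩
      Z ∎
      where open ≡-Reasoning

    ∣transplant∣ : ∀ Z → ∣ transplant X Y Z ∣ ≡ ∣ Y ∣ ℕ.+ ∣ restrict (∁ X) Z ∣
    ∣transplant∣ Z = trans (∣∪-extend∣ Y _) (cong (∣ Y ∣ ℕ.+_) (∣resize∣ ∣∁X∣≡∣∁Y∣ _))

diff-pos : ∀ {a b : ℤ} → b ℤ.< a → + 0 ℤ.< a - b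
diff-pos {a} {b} b<a = subst (ℤ._< a - b) (ℤP.+-inverseʳ b) (ℤP.+-monoˡ-< (- b) b<a)

diff-pos⁻ : ∀ {a b : ℤ} → + 0 ℤ.< a - b → b ℤ.< a
diff-pos⁻ {a} {b} 0<a-b = subst₂ ℤ._<_ (ℤP.+-identityˡ b) (a-b+b≡a a b) (ℤP.+-monoˡ-< b 0<a-b)
  where
  a-b+b≡a : ∀ (a b : ℤ) → (a - b) + b ≡ a
  a-b+b≡a = solve-∀

codim-pos : ∀ d {n} (Z : Subset n) → ∣ Z ∣ ℕ.≤ d → + 0 ℤ.< codim d Z
codim-pos d Z ∣Z∣≤d = diff-pos (ℤ.+<+ (s≤s ∣Z∣≤d))

codim-pos⁻ : ∀ d {n} (Z : Subset n) → + 0 ℤ.< codim d Z → ∣ Z ∣ ℕ.≤ d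
codim-pos⁻ d Z 0<codim = ℕP.≤-pred (ℤP.drop‿+<+ (diff-pos⁻ 0<codim))

codim-grow : ∀ d {n} (X Z : Subset n) k → ∣ Z ∣ ≡ ∣ X ∣ ℕ.+ k → codim d Z ≡ codim d X - + k
codim-grow d X Z k ∣Z∣≡ = begin
  + suc d - + ∣ Z ∣             ≡⟨ cong (λ z → + suc d - + z) ∣Z∣≡ ⟩
  + suc d - + (∣ X ∣ ℕ.+ k)     ≡⟨ cong (λ z → + suc d - z) (ℤP.pos-+ ∣ X ∣ k) ⟩
  + suc d - (+ ∣ X ∣ + + k)     ≡⟨ s-[x+k]≡[s-x]-k (+ suc d) (+ ∣ X ∣) (+ k) ⟩
  (+ suc d - + ∣ X ∣) - + k     ∎
  where
  open ≡-Reasoning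
  s-[x+k]≡[s-x]-k : ∀ (s x k : ℤ) → s - (x + k) ≡ (s - x) - k
  s-[x+k]≡[s-x]-k = solve-∀

codim+u : ∀ d u (X : Subset (d ℕ.+ u)) → codim d X + + u ≡ + suc ∣ ∁ X ∣
codim+u d u X = begin
  (+ suc d - + x) + + u   ≡⟨ reassoc (+ suc d) (+ x) (+ u) ⟩
  (+ suc d + + u) - + x   ≡⟨ cong (_- + x) (sym (ℤP.pos-+ (suc d) u)) ⟩
  + (suc d ℕ.+ u) - + x   ≡⟨ cong (λ z → + z - + x) size ⟩
  + (x ℕ.+ suc c) - + x   ≡⟨ cong (_- + x) (ℤP.pos-+ x (suc c)) ⟩
  (+ x + + suc c) - + x   ≡⟨ cancel (+ x) (+ suc c) ⟩
  + suc c                 ∎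
  where
  open ≡-Reasoning
  x = ∣ X ∣
  c = ∣ ∁ X ∣
  reassoc : ∀ (s x u : ℤ) → (s - x) + u ≡ (s + u) - x
  reassoc = solve-∀
  cancel : ∀ (x c : ℤ) → (x + c) - x ≡ c
  cancel = solve-∀
  size : suc (d ℕ.+ u) ≡ x ℕ.+ suc c
  size = trans (cong suc (sym (∣p∣+∣∁p∣≡n X))) (sym (ℕP.+-suc x c))

codim≡⇒∣∁∣≡ : ∀ d d′ u (X : Subset (d ℕ.+ u)) (Y : Subset (d′ ℕ.+ u)) →
              codim d X ≡ codim d′ Y → ∣ ∁ X ∣ ≡ ∣ ∁ Y ∣
codim≡⇒∣∁∣≡ d d′ u X Y codim≡ =
  ℕP.suc-injective (ℤP.+-injective (trans (sym (codim+u d u X)) (trans (cong (_+ + u) codim≡) (codim+u d′ u Y))))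

codim-transplant : ∀ d d′ {n n′} (X : Subset n) (Y : Subset n′) → ∣ ∁ X ∣ ≡ ∣ ∁ Y ∣ →
                   codim d X ≡ codim d′ Y → ∀ Z → X ⊆ Z → codim d′ (transplant X Y Z) ≡ codim d Z
codim-transplant d d′ X Y ∣∁∣≡ codim≡ Z X⊆Z = begin
  codim d′ (transplant X Y Z) ≡⟨ codim-grow d′ Y (transplant X Y Z) k (Transplant.∣transplant∣ X Y ∣∁∣≡ Z) ⟩
  codim d′ Y - + k            ≡⟨ cong (_- + k) codim≡ ⟨
  codim d X - + k             ≡⟨ codim-grow d X Z k (∣restrict-∁∣ X Z X⊆Z) ⟨
  codim d Z                   ∎
  where
  open ≡-Reasoning
  k = ∣ restrict (∁ X) Z ∣

-- The defect D_d and its behaviour under concatenation.  'cross d P Q'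
-- is the correction term D_d({P,Q}) when the two parts are merged.

cross : ℕ → ∀ {n} → Subset n → Subset n → ℤ
cross d P Q = codim d (P ∩ Q) - (codim d P + codim d Q)

cross≡ : ∀ d {n} (P Q : Subset n) → cross d P Q ≡ + ∣ P ∪ Q ∣ - + suc d
cross≡ d P Q = begin
  (s - + i) - ((s - + p) + (s - + q))       ≡⟨ regroup s (+ i) (+ p) (+ q) (+ w) ⟩
  (+ w - s) + ((+ p + + q) - (+ i + + w))   ≡⟨ cong₂ (λ a b → (+ w - s) + (a - b)) (sym (ℤP.pos-+ p q)) (sym (ℤP.pos-+ i w)) ⟩
  (+ w - s) + (+ (p ℕ.+ q) - + (i ℕ.+ w))   ≡⟨ cong (λ z → (+ w - s) + (+ (p ℕ.+ q) - + z)) (∣p∩q∣+∣p∪q∣ P Q) ⟩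
  (+ w - s) + (+ (p ℕ.+ q) - + (p ℕ.+ q))   ≡⟨ cong (λ z → (+ w - s) + z) (ℤP.+-inverseʳ (+ (p ℕ.+ q))) ⟩
  (+ w - s) + + 0                           ≡⟨ ℤP.+-identityʳ _ ⟩
  + w - s                                   ∎
  where
  open ≡-Reasoning
  s = + suc d
  i = ∣ P ∩ Q ∣
  w = ∣ P ∪ Q ∣
  p = ∣ P ∣
  q = ∣ Q ∣
  regroup : ∀ (s i a b w : ℤ) → (s - i) - ((s - a) + (s - b)) ≡ (w - s) + ((a + b) - (i + w))
  regroup = solve-∀

cross-mono : ∀ d {n} {P Q P′ Q′ : Subset n} → P ⊆ P′ → Q ⊆ Q′ → cross d P Q ℤ.≤ cross d P′ Q′
cross-mono d {P = P} {Q} {P′} {Q′} P⊆P′ Q⊆Q′ =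
  subst₂ ℤ._≤_ (sym (cross≡ d P Q)) (sym (cross≡ d P′ Q′))
    (ℤP.+-monoˡ-≤ (- + suc d) (ℤ.+≤+ (SubP.p⊆q⇒∣p∣≤∣q∣ (∪-mono P⊆P′ Q⊆Q′))))

module _ {n : ℕ} where

  ⋂-↭ : ∀ {xs ys : List (Subset n)} → xs ↭ ys → ⋂ xs ≡ ⋂ ys
  ⋂-↭ = foldr-↭ (SubP.∩-isCommutativeMonoid n)

  ρ≡sum : ∀ d (xs : List (Subset n)) → ρ d xs ≡ sumℤ (map (codim d) xs)
  ρ≡sum d []       = refl
  ρ≡sum d (x ∷ xs) = cong (λ r → codim d x + r) (ρ≡sum d xs)

  ρ-↭ : ∀ d {xs ys : List (Subset n)} → xs ↭ ys → ρ d xs ≡ ρ d ys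
  ρ-↭ d {xs} {ys} xs↭ys =
    trans (ρ≡sum d xs) (trans (sumℤ-↭ (PermP.map⁺ (codim d) xs↭ys)) (sym (ρ≡sum d ys)))

  D-↭ : ∀ d {xs ys : List (Subset n)} → xs ↭ ys → D d xs ≡ D d ys
  D-↭ d xs↭ys = cong₂ (λ a b → codim d a - b) (⋂-↭ xs↭ys) (ρ-↭ d xs↭ys)

  ⋂-++ : ∀ (xs ys : List (Subset n)) → ⋂ (xs ++ ys) ≡ ⋂ xs ∩ ⋂ ys
  ⋂-++ []       ys = sym (SubP.∩-identityˡ (⋂ ys))
  ⋂-++ (x ∷ xs) ys = trans (cong (x ∩_) (⋂-++ xs ys)) (sym (SubP.∩-assoc x (⋂ xs) (⋂ ys)))

  ρ-++ : ∀ d (xs ys : List (Subset n)) → ρ d (xs ++ ys) ≡ ρ d xs + ρ d ys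
  ρ-++ d []       ys = sym (ℤP.+-identityˡ (ρ d ys))
  ρ-++ d (x ∷ xs) ys = trans (cong (λ r → codim d x + r) (ρ-++ d xs ys)) (sym (ℤP.+-assoc (codim d x) (ρ d xs) (ρ d ys)))

  D-++ : ∀ d (xs ys : List (Subset n)) → D d (xs ++ ys) ≡ (D d xs + D d ys) + cross d (⋂ xs) (⋂ ys)
  D-++ d xs ys = trans (cong₂ (λ a b → codim d a - b) (⋂-++ xs ys) (ρ-++ d xs ys))
                       (regroup (codim d (⋂ xs ∩ ⋂ ys)) (ρ d xs) (ρ d ys) (codim d (⋂ xs)) (codim d (⋂ ys)))
    where
    regroup : ∀ (c a b cA cB : ℤ) → c - (a + b) ≡ ((cA - a) + (cB - b)) + (c - (cA + cB))
    regroup = solve-∀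

  D-∷ : ∀ d (Y : Subset n) (J : List (Subset n)) → D d (Y ∷ J) ≡ D d J + cross d Y (⋂ J)
  D-∷ d Y J = regroup (codim d (Y ∩ ⋂ J)) (codim d Y) (ρ d J) (codim d (⋂ J))
    where
    regroup : ∀ (c y r cJ : ℤ) → c - (y + r) ≡ (cJ - r) + (c - (y + cJ))
    regroup = solve-∀

  D-[_] : ∀ d (Z : Subset n) → D d (Z ∷ []) ≡ + 0
  D-[_] d Z = trans (cong₂ (λ w v → codim d w - v) (SubP.∩-identityʳ Z) (ℤP.+-identityʳ (codim d Z)))
                    (ℤP.+-inverseʳ (codim d Z))

  ⊆⋂ : ∀ {Y : Subset n} {R} → All (Y ⊆_) R → Y ⊆ ⋂ R
  ⊆⋂ []              = λ _ → SubP.∈⊤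
  ⊆⋂ (Y⊆Z ∷ Y⊆⋂R) x∈Y = SubP.x∈p∩q⁺ (Y⊆Z x∈Y , ⊆⋂ Y⊆⋂R x∈Y)

  -- A set of size ≤ d contains at most one member of an L-collection:
  -- D_d({A,B}) > 0 means |A ∪ B| > d + 1.
  small-set-separates : ∀ d (A B Z : Subset n) → A ⊆ Z → B ⊆ Z → ∣ Z ∣ ℕ.≤ d →
                        ¬ (+ 0 ℤ.< D d (A ∷ B ∷ []))
  small-set-separates d A B Z A⊆Z B⊆Z ∣Z∣≤d 0<D = ℕP.<⇒≱ d+1<∣A∪B∣ ∣A∪B∣≤d+1
    where
    D≡cross : D d (A ∷ B ∷ []) ≡ cross d A B
    D≡cross = cong₂ (λ w v → codim d (A ∩ w) - (codim d A + v)) (SubP.∩-identityʳ B) (ℤP.+-identityʳ (codim d B))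
    d+1<∣A∪B∣ : suc d ℕ.< ∣ A ∪ B ∣
    d+1<∣A∪B∣ = ℤP.drop‿+<+ (diff-pos⁻ (subst (+ 0 ℤ.<_) (trans D≡cross (cross≡ d A B)) 0<D))
    ∣A∪B∣≤d+1 : ∣ A ∪ B ∣ ℕ.≤ suc d
    ∣A∪B∣≤d+1 = ℕP.≤-trans (SubP.p⊆q⇒∣p∣≤∣q∣ (∪-least A⊆Z B⊆Z)) (ℕP.m≤n⇒m≤1+n ∣Z∣≤d)

-- Let Gs be a list of "generators" and R a
-- collection each of whose members contains some generator.  Sorting R
-- into groups by the first generator they contain, D is superadditive
-- over the groups up to the cross terms, which only grow when the groups
-- are replaced by their generators.  Hence D_d(R) ≥ D_d(J) for the list J
-- of generators actually used, and if only one generator is used then R is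
-- a single group.

filter-partition : ∀ {A : Set} {P : Pred A Agda.Primitive.lzero} (P? : Decidable P) (xs : List A) →
                   xs ↭ filter P? xs ++ filter (¬? ∘ P?) xs
filter-partition P? []       = ↭-refl
filter-partition P? (x ∷ xs) with P? x
... | yes _ = prep x (filter-partition P? xs)
... | no _  = ↭-trans (prep x (filter-partition P? xs)) (↭-sym (PermP.shift x (filter P? xs) _))

Positive : ℕ → ∀ {n} → Coll n → Set
Positive d R = 2 ℕ.≤ length R → + 0 ℤ.< D d R

module Grouping (n d : ℕ) where

  Generated : List (Subset n) → Subset n → Set
  Generated Gs Z = Any (λ Y → Y ⊆ Z) Gs

  GroupwisePositive : List (Subset n) → List (Subset n) → Set
  GroupwisePositive Gs R = ∀ {Q} → Q ⊑ R → ∀ {Y} → Y ∈ₗ Gs → All (Y ⊆_) Q → Positive d Q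

  positive⇒nonneg : ∀ (R : List (Subset n)) → R ≢ [] → Positive d R → + 0 ℤ.≤ D d R
  positive⇒nonneg []          R≢[] _   = ⊥-elim (R≢[] refl)
  positive⇒nonneg (Z ∷ [])    _    _   = ℤP.≤-reflexive (sym (D-[_] d Z))
  positive⇒nonneg (_ ∷ _ ∷ _) _    pos = ℤP.<⇒≤ (pos (s≤s (s≤s z≤n)))

  record Grouped (Gs R : List (Subset n)) : Set where
    field
      generators    : List (Subset n)
      generators⊑   : generators ⊑ Gs
      nonempty      : generators ≢ []
      D-generators≤ : D d generators ℤ.≤ D d R
      one-generator : length generators ≡ 1 → Positive d R
      ⋂-generators⊆ : ⋂ generators ⊆ ⋂ R

  grouped-↭ : ∀ {Gs R R′} → R ↭ R′ → Grouped Gs R′ → Grouped Gs R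
  grouped-↭ {R = R} R↭R′ g = record
    { generators    = generators
    ; generators⊑   = generators⊑
    ; nonempty      = nonempty
    ; D-generators≤ = subst (D d generators ℤ.≤_) (sym (D-↭ d R↭R′)) D-generators≤
    ; one-generator = λ one 2≤R → subst (+ 0 ℤ.<_) (sym (D-↭ d R↭R′))
                        (one-generator one (subst (2 ℕ.≤_) (PermP.↭-length R↭R′) 2≤R))
    ; ⋂-generators⊆ = λ x∈ → subst (_ ∈_) (sym (⋂-↭ R↭R′)) (⋂-generators⊆ x∈)
    }
    where open Grouped g

  grouped-skip : ∀ {Y Gs R} → Grouped Gs R → Grouped (Y ∷ Gs) R
  grouped-skip g = record
    { generators = generators ; generators⊑ = _ ∷ʳ generators⊑ ; nonempty = nonempty
    ; D-generators≤ = D-generators≤ ; one-generator = one-generator ; ⋂-generators⊆ = ⋂-generators⊆ }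
    where open Grouped g

  grouped-one : ∀ {Y Gs} R₁ → R₁ ≢ [] → All (Y ⊆_) R₁ → Positive d R₁ → Grouped (Y ∷ Gs) R₁
  grouped-one {Y} R₁ R₁≢[] Y⊆R₁ pos = record
    { generators    = Y ∷ []
    ; generators⊑   = refl ∷ Sublist.minimum _
    ; nonempty      = λ ()
    ; D-generators≤ = subst (ℤ._≤ D d R₁) (sym (D-[_] d Y)) (positive⇒nonneg R₁ R₁≢[] pos)
    ; one-generator = λ _ → pos
    ; ⋂-generators⊆ = ⊆⋂ Y⊆R₁ ∘ SubP.p∩q⊆p Y ⊤
    }

  -- A new group in front of a grouped collection: superadditivity of D.
  grouped-∷ : ∀ {Y Gs} R₁ R₂ → R₁ ≢ [] → All (Y ⊆_) R₁ → Positive d R₁ →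
              Grouped Gs R₂ → Grouped (Y ∷ Gs) (R₁ ++ R₂)
  grouped-∷ {Y} R₁ R₂ R₁≢[] Y⊆R₁ pos g = record
    { generators    = Y ∷ generators
    ; generators⊑   = refl ∷ generators⊑
    ; nonempty      = λ ()
    ; D-generators≤ = subst₂ ℤ._≤_ (sym (D-∷ d Y generators)) (sym (D-++ d R₁ R₂))
        (ℤP.+-mono-≤ (subst (ℤ._≤ D d R₁ + D d R₂) (ℤP.+-identityˡ (D d generators))
                       (ℤP.+-mono-≤ (positive⇒nonneg R₁ R₁≢[] pos) D-generators≤))
                     (cross-mono d (⊆⋂ Y⊆R₁) ⋂-generators⊆))
    ; one-generator = λ one → ⊥-elim (nonempty (single one))
    ; ⋂-generators⊆ = λ x∈ → subst (_ ∈_) (sym (⋂-++ R₁ R₂)) (∩-mono (⊆⋂ Y⊆R₁) ⋂-generators⊆ x∈)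
    }
    where
    open Grouped g
    single : ∀ {J : List (Subset n)} → length (Y ∷ J) ≡ 1 → J ≡ []
    single {[]} _ = refl

  grouping : ∀ Gs R → All (Generated Gs) R → GroupwisePositive Gs R → R ≡ [] ⊎ Grouped Gs R
  grouping []       []      _            _   = inj₁ refl
  grouping []       (_ ∷ _) (() ∷ _)     _
  grouping (Y ∷ Gs) R       generated    pos =
    regroup R₁ R₂ Y⊆R₁ (filter-partition (Y ⊆?_) R) (pos (SublistP.filter-⊆ (Y ⊆?_) R) (here refl) Y⊆R₁)
            (grouping Gs R₂ generated₂ pos₂)
    where
    open SubP using (_⊆?_)
    R₁ = filter (Y ⊆?_) R
    R₂ = filter (¬? ∘ (Y ⊆?_)) R
    Y⊆R₁ : All (Y ⊆_) R₁
    Y⊆R₁ = All.tabulate (λ Z∈ → proj₂ (∈-filter⁻ (Y ⊆?_) {xs = R} Z∈))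
    generated₂ : All (Generated Gs) R₂
    generated₂ = All.tabulate λ Z∈ → later (∈-filter⁻ (¬? ∘ (Y ⊆?_)) {xs = R} Z∈)
      where
      later : ∀ {Z} → Z ∈ₗ R × ¬ (Y ⊆ Z) → Generated Gs Z
      later (Z∈R , Y⊈Z) with All.lookup generated Z∈R
      ... | here Y⊆Z    = ⊥-elim (Y⊈Z Y⊆Z)
      ... | there Gs⊆Z  = Gs⊆Z
    pos₂ : GroupwisePositive Gs R₂
    pos₂ Q⊑ Y′∈ = pos (Sublist.⊆-trans Q⊑ (SublistP.filter-⊆ (¬? ∘ (Y ⊆?_)) R)) (there Y′∈)
    regroup : ∀ R₁′ R₂′ → All (Y ⊆_) R₁′ → R ↭ R₁′ ++ R₂′ → Positive d R₁′ → R₂′ ≡ [] ⊎ Grouped Gs R₂′ →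
              R ≡ [] ⊎ Grouped (Y ∷ Gs) R
    regroup []        _   _    R↭ _    (inj₁ refl) = inj₁ (PermP.↭-empty-inv R↭)
    regroup []        _   _    R↭ _    (inj₂ g)    = inj₂ (grouped-↭ R↭ (grouped-skip g))
    regroup (Z ∷ R₁′) _   Y⊆R₁ R↭ pos₁ (inj₁ refl) =
      inj₂ (grouped-↭ (↭-trans R↭ (↭-reflexive (ListP.++-identityʳ _))) (grouped-one (Z ∷ R₁′) (λ ()) Y⊆R₁ pos₁))
    regroup (Z ∷ R₁′) R₂′ Y⊆R₁ R↭ pos₁ (inj₂ g)   = inj₂ (grouped-↭ R↭ (grouped-∷ (Z ∷ R₁′) R₂′ (λ ()) Y⊆R₁ pos₁ g))

  positive-by-groups : ∀ Gs R → All (Generated Gs) R → GroupwisePositive Gs R →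
                       (∀ {J} → J ⊑ Gs → Positive d J) → Positive d R
  positive-by-groups Gs R generated pos posGs 2≤R with grouping Gs R generated pos
  ... | inj₁ refl = ⊥-elim (ℕP.<⇒≱ 2≤R z≤n)
  ... | inj₂ g with Grouped.generators g | Grouped.generators⊑ g | Grouped.nonempty g
                  | Grouped.D-generators≤ g | Grouped.one-generator g
  ...   | []          | _  | J≢[] | _   | _   = ⊥-elim (J≢[] refl)
  ...   | _ ∷ []      | _  | _    | _   | one = one refl 2≤R
  ...   | _ ∷ _ ∷ _   | J⊑ | _    | D≤  | _   = ℤP.<-≤-trans (posGs J⊑ (s≤s (s≤s z≤n))) D≤

IsL⇒positive : ∀ {n d} {S : Coll n} → IsL d S → ∀ {Q} → Q ⊑ S → Positive d Q
IsL⇒positive (positive , _) Q⊑S = All.lookup positive (⊑⇒∈-sublists Q⊑S)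

positive⇒IsL : ∀ {n d} {S : Coll n} → (∀ {Q} → Q ⊑ S → Positive d Q) → All (λ X → ∣ X ∣ ℕ.≤ d) S → IsL d S
positive⇒IsL {S = S} positive small = All.tabulate (positive ∘ ∈-sublists⇒⊑ S) , small

positive-↭ : ∀ {n d} {xs ys : Coll n} → xs ↭ ys → IsL d ys → ∀ {Q} → Q ⊑ xs → Positive d Q
positive-↭ {d = d} xs↭ys isL Q⊑xs with ⊑-↭ xs↭ys Q⊑xs
... | Q′ , Q′⊑ys , Q↭Q′ = λ 2≤Q → subst (+ 0 ℤ.<_) (D-↭ d (↭-sym Q↭Q′))
                            (IsL⇒positive isL Q′⊑ys (subst (2 ℕ.≤_) (PermP.↭-length Q↭Q′) 2≤Q))

IsL-↭ : ∀ {n} d {xs ys : Coll n} → xs ↭ ys → IsL d xs → IsL d ys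
IsL-↭ d xs↭ys isL = positive⇒IsL (positive-↭ (↭-sym xs↭ys) isL) (PermP.All-resp-↭ xs↭ys (proj₂ isL))

at-most-one-inside : ∀ {A : Set} {n} d (f : A → Subset n) (xs : List A) → DecidableEquality A →
                     (∀ {J} → J ⊑ map f xs → Positive d J) →
                     ∀ {W} → ∣ W ∣ ℕ.≤ d → ∀ {x y} → x ∈ₗ xs → y ∈ₗ xs → f x ⊆ W → f y ⊆ W → x ≡ y
at-most-one-inside d f xs _≟_ positive ∣W∣≤d {x} {y} x∈ y∈ fx⊆W fy⊆W with x ≟ y
... | yes x≡y = x≡y
... | no x≢y with pair-⊑ x∈ y∈ x≢y
...   | inj₁ xy⊑ = ⊥-elim (small-set-separates d (f x) (f y) _ fx⊆W fy⊆W ∣W∣≤d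
                            (positive (SublistP.map⁺ f xy⊑) (s≤s (s≤s z≤n))))
...   | inj₂ yx⊑ = ⊥-elim (small-set-separates d (f y) (f x) _ fy⊆W fx⊆W ∣W∣≤d
                            (positive (SublistP.map⁺ f yx⊑) (s≤s (s≤s z≤n))))

Pair : ℕ → ℕ → Set
Pair n n′ = Subset n × Subset n′

_≟P_ : ∀ {n n′} → DecidableEquality (Pair n n′)
_≟P_ = ProdP.≡-dec (VecP.≡-dec BoolP._≟_) (VecP.≡-dec BoolP._≟_)

transplant-along : ∀ {n n′} → Pair n n′ → Subset n → Subset n′
transplant-along (X , Y) = transplant X Y

glue : ∀ {n n′} → List (Pair n n′) → Subset n → Subset n′
glue []             Z = ⊤
glue ((X , Y) ∷ ps) Z with X SubP.⊆? Z
... | yes _ = transplant X Y Z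
... | no _  = glue ps Z

glue-agrees : ∀ {n n′} (ps : List (Pair n n′)) {Z} →
              (∀ {p q} → p ∈ₗ ps → q ∈ₗ ps → proj₁ p ⊆ Z → proj₁ q ⊆ Z → p ≡ q) →
              ∀ {p} → p ∈ₗ ps → proj₁ p ⊆ Z → glue ps Z ≡ transplant-along p Z
glue-agrees ((X , Y) ∷ ps) {Z} unique p∈ Xp⊆Z with X SubP.⊆? Z
... | yes X⊆Z = cong (λ q → transplant-along q Z) (unique (here refl) p∈ X⊆Z Xp⊆Z)
... | no X⊈Z with p∈
...   | here refl = ⊥-elim (X⊈Z Xp⊆Z)
...   | there p∈ps = glue-agrees ps (λ p∈ q∈ → unique (there p∈) (there q∈)) p∈ps Xp⊆Z

SmallOver : ℕ → ∀ {n} → List (Subset n) → Subset n → Set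
SmallOver d Gs Z = ∣ Z ∣ ℕ.≤ d × Any (λ X → X ⊆ Z) Gs

module Gluing {n n′} (d d′ : ℕ) (ps : List (Pair n n′))
  (∣∁∣≡  : All (λ p → ∣ ∁ (proj₁ p) ∣ ≡ ∣ ∁ (proj₂ p) ∣) ps)
  (codim≡ : All (λ p → codim d (proj₁ p) ≡ codim d′ (proj₂ p)) ps)
  (positive-Xs : ∀ {J} → J ⊑ map proj₁ ps → Positive d J)
  (positive-Ys : ∀ {J} → J ⊑ map proj₂ ps → Positive d′ J) where

  Xs = map proj₁ ps
  Ys = map proj₂ ps

  σ : Subset n → Subset n′
  σ = glue ps

  unique-X : ∀ {Z} → ∣ Z ∣ ℕ.≤ d → ∀ {p q} → p ∈ₗ ps → q ∈ₗ ps → proj₁ p ⊆ Z → proj₁ q ⊆ Z → p ≡ q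
  unique-X = at-most-one-inside d proj₁ ps _≟P_ positive-Xs

  unique-Y : ∀ {W} → ∣ W ∣ ℕ.≤ d′ → ∀ {p q} → p ∈ₗ ps → q ∈ₗ ps → proj₂ p ⊆ W → proj₂ q ⊆ W → p ≡ q
  unique-Y = at-most-one-inside d′ proj₂ ps _≟P_ positive-Ys

  codim-along : ∀ {p} → p ∈ₗ ps → ∀ Z → proj₁ p ⊆ Z → codim d′ (transplant-along p Z) ≡ codim d Z
  codim-along {X , Y} p∈ = codim-transplant d d′ X Y (All.lookup ∣∁∣≡ p∈) (All.lookup codim≡ p∈)

  record Generator (Z : Subset n) : Set where
    field
      pair    : Pair n n′
      pair∈   : pair ∈ₗ ps
      X⊆Z     : proj₁ pair ⊆ Z
      σ≡      : σ Z ≡ transplant-along pair Z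

  generator : ∀ {Z} → SmallOver d Xs Z → Generator Z
  generator {Z} (∣Z∣≤d , over) with ListMem.find (AnyP.map⁻ over)
  ... | p , p∈ , X⊆Z = record { pair = p ; pair∈ = p∈ ; X⊆Z = X⊆Z ; σ≡ = glue-agrees ps (unique-X ∣Z∣≤d) p∈ X⊆Z }

  codim-σ : ∀ {Z} → SmallOver d Xs Z → codim d′ (σ Z) ≡ codim d Z
  codim-σ {Z} over = trans (cong (codim d′) σ≡) (codim-along pair∈ Z X⊆Z)
    where open Generator (generator over)

  Y⊆σ : ∀ {Z} (g : Generator Z) → proj₂ (Generator.pair g) ⊆ σ Z
  Y⊆σ {Z} g = subst (_ ⊆_) (sym σ≡) (Transplant.⊆-transplant (proj₁ pair) (proj₂ pair) Z)
    where open Generator g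

  σ-SmallOver : ∀ {Z} → SmallOver d Xs Z → SmallOver d′ Ys (σ Z)
  σ-SmallOver {Z} over@(∣Z∣≤d , _) =
      codim-pos⁻ d′ (σ Z) (subst (+ 0 ℤ.<_) (sym (codim-σ over)) (codim-pos d Z ∣Z∣≤d))
    , ListMem.lose (∈-map⁺ proj₂ (Generator.pair∈ g)) (Y⊆σ g)
    where g = generator over

  -- Around Z, σ is a single transplant: σ is monotone on small sets over Xs.
  σ-mono : ∀ {A B} → SmallOver d Xs A → SmallOver d Xs B → B ⊆ A → σ B ⊆ σ A
  σ-mono {A} {B} overA overB B⊆A =
    subst₂ _⊆_ (sym σ≡) (sym σA≡) (Transplant.transplant-mono (proj₁ pair) (proj₂ pair) B⊆A)
    where
    open Generator (generator overB)
    σA≡ : σ A ≡ transplant-along pair A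
    σA≡ = glue-agrees ps (unique-X (proj₁ overA)) pair∈ (B⊆A ∘ X⊆Z)

  generator-by-Y : ∀ {Z} (over : SmallOver d Xs Z) → ∀ {p} → p ∈ₗ ps → proj₂ p ⊆ σ Z → p ≡ Generator.pair (generator over)
  generator-by-Y over p∈ Yp⊆ = unique-Y (proj₁ (σ-SmallOver over)) p∈ (Generator.pair∈ g) Yp⊆ (Y⊆σ g)
    where g = generator over

  -- On a group of sets over one X_p, σ is the transplant along p, so it
  -- preserves ⋂, ρ and hence D.
  module _ {p} (p∈ : p ∈ₗ ps) where

    ⋂-along : ∀ (P : List (Subset n)) → ⋂ (map (transplant-along p) P) ≡ transplant-along p (⋂ P)
    ⋂-along []      = sym (Transplant.transplant-⊤ (proj₁ p) (proj₂ p) (All.lookup ∣∁∣≡ p∈))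
    ⋂-along (Z ∷ P) = trans (cong (transplant-along p Z ∩_) (⋂-along P))
                            (sym (Transplant.transplant-∩ (proj₁ p) (proj₂ p) Z (⋂ P)))

    ρ-along : ∀ (P : List (Subset n)) → All (proj₁ p ⊆_) P → ρ d′ (map (transplant-along p) P) ≡ ρ d P
    ρ-along []      _             = refl
    ρ-along (Z ∷ P) (X⊆Z ∷ X⊆P)  = cong₂ _+_ (codim-along p∈ Z X⊆Z) (ρ-along P X⊆P)

    D-along : ∀ (P : List (Subset n)) → All (proj₁ p ⊆_) P → D d′ (map (transplant-along p) P) ≡ D d P
    D-along P X⊆P = cong₂ _-_
      (trans (cong (codim d′) (⋂-along P)) (codim-along p∈ (⋂ P) (⊆⋂ X⊆P)))
      (ρ-along P X⊆P)

  IsL-σ : ∀ {S} → IsL d S → All (SmallOver d Xs) S → IsL d′ (map σ S)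
  IsL-σ {S} isL over = positive⇒IsL positive (AllP.map⁺ (All.map (proj₁ ∘ σ-SmallOver) over))
    where
    open Grouping n′ d′ using (positive-by-groups)
    positive : ∀ {Q} → Q ⊑ map σ S → Positive d′ Q
    positive Q⊑ with ⊑-map⁻ σ Q⊑
    ... | Q₀ , Q₀⊑S , refl =
      positive-by-groups Ys (map σ Q₀) generated groupwise positive-Ys
      where
      over-Q₀ : ∀ {Z} → Z ∈ₗ Q₀ → SmallOver d Xs Z
      over-Q₀ Z∈ = All.lookup over (Sublist.lookup Q₀⊑S Z∈)
      generated : All (λ W → Any (λ Y → Y ⊆ W) Ys) (map σ Q₀)
      generated = AllP.map⁺ (All.tabulate (proj₂ ∘ σ-SmallOver ∘ over-Q₀))
      groupwise : ∀ {P} → P ⊑ map σ Q₀ → ∀ {Y} → Y ∈ₗ Ys → All (Y ⊆_) P → Positive d′ P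
      groupwise P⊑ Y∈ Y⊆P with ⊑-map⁻ σ P⊑ | ∈-map⁻ proj₂ Y∈
      ... | P₀ , P₀⊑Q₀ , refl | p , p∈ , refl = λ 2≤P →
        subst (+ 0 ℤ.<_) (sym D≡) (IsL⇒positive isL (Sublist.⊆-trans P₀⊑Q₀ Q₀⊑S) (subst (2 ℕ.≤_) (ListP.length-map σ P₀) 2≤P))
        where
        in-group : ∀ {Z} → Z ∈ₗ P₀ → proj₁ p ⊆ Z × σ Z ≡ transplant-along p Z
        in-group {Z} Z∈ = subst (λ q → proj₁ q ⊆ Z × σ Z ≡ transplant-along q Z) (sym p≡) (X⊆Z , σ≡)
          where
          over-Z : SmallOver d Xs Z
          over-Z = over-Q₀ (Sublist.lookup P₀⊑Q₀ Z∈)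
          open Generator (generator over-Z)
          p≡ : p ≡ pair
          p≡ = generator-by-Y over-Z p∈ (All.lookup Y⊆P (∈-map⁺ σ Z∈))
        D≡ : D d′ (map σ P₀) ≡ D d P₀
        D≡ = trans (cong (D d′) (ListP.map-cong-local (All.tabulate (proj₂ ∘ in-group))))
                   (D-along p∈ P₀ (All.tabulate (proj₁ ∘ in-group)))

-- Canonical representatives.  A collection is a member of L only in the
-- order of the enumeration 'allSubsets'; 'canon' reorders a list of
-- subsets accordingly.

filter-cong-on : ∀ {A : Set} {P Q : Pred A Agda.Primitive.lzero} (P? : Decidable P) (Q? : Decidable Q) (ys : List A) →
                 (∀ {y} → y ∈ₗ ys → P y → Q y) → (∀ {y} → y ∈ₗ ys → Q y → P y) → filter P? ys ≡ filter Q? ys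
filter-cong-on P? Q? []       P⇒Q Q⇒P = refl
filter-cong-on P? Q? (y ∷ ys) P⇒Q Q⇒P with P? y | Q? y
... | yes _  | yes _  = cong (y ∷_) (filter-cong-on P? Q? ys (P⇒Q ∘ there) (Q⇒P ∘ there))
... | yes py | no ¬qy = ⊥-elim (¬qy (P⇒Q (here refl) py))
... | no ¬py | yes qy = ⊥-elim (¬py (Q⇒P (here refl) qy))
... | no _   | no _   = filter-cong-on P? Q? ys (P⇒Q ∘ there) (Q⇒P ∘ there)

module Canonical (m : ℕ) where

  _∈?_ : (Z : Subset m) (xs : Coll m) → Dec (Z ∈ₗ xs)
  Z ∈? xs = Any.any? (VecP.≡-dec BoolP._≟_ Z) xs

  canon : Coll m → Coll m
  canon xs = filter (_∈? xs) (allSubsets m)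

  canon-∈⁻ : ∀ {xs Z} → Z ∈ₗ canon xs → Z ∈ₗ xs
  canon-∈⁻ {xs} Z∈ = proj₂ (∈-filter⁻ (_∈? xs) {xs = allSubsets m} Z∈)

  canon-∈⁺ : ∀ {xs Z} → Z ∈ₗ xs → Z ∈ₗ canon xs
  canon-∈⁺ {xs} {Z} Z∈ = ∈-filter⁺ (_∈? xs) (allSubsets-complete m Z) Z∈

  canon-↭ : ∀ {xs} → Unique xs → canon xs ↭ xs
  canon-↭ {xs} uxs = same-members⇒↭ (UniqueP.filter⁺ (_∈? xs) (unique-allSubsets m)) uxs canon-∈⁻ canon-∈⁺

  canon-cong : ∀ {xs ys} → (∀ {Z} → Z ∈ₗ xs → Z ∈ₗ ys) → (∀ {Z} → Z ∈ₗ ys → Z ∈ₗ xs) → canon xs ≡ canon ys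
  canon-cong {xs} {ys} xs⊆ys ys⊆xs = filter-cong-on (_∈? xs) (_∈? ys) (allSubsets m) (λ _ → xs⊆ys) (λ _ → ys⊆xs)

  filter-members : ∀ {ys xs : Coll m} → Unique ys → xs ⊑ ys → filter (_∈? xs) ys ≡ xs
  filter-members _ [] = refl
  filter-members {y ∷ ys} {xs} (y∉ys ∷ uys) (_ ∷ʳ xs⊑ys) =
    trans (ListP.filter-reject (_∈? xs) (λ y∈xs → All.lookup y∉ys (Sublist.lookup xs⊑ys y∈xs) refl))
          (filter-members uys xs⊑ys)
  filter-members {x ∷ ys} {x ∷ xs} (x∉ys ∷ uys) (refl ∷ xs⊑ys) =
    trans (ListP.filter-accept (_∈? (x ∷ xs)) (here refl))
      (cong (x ∷_) (trans (filter-cong-on (_∈? (x ∷ xs)) (_∈? xs) ys drop-x (λ _ → there)) (filter-members uys xs⊑ys)))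
    where
    drop-x : ∀ {y} → y ∈ₗ ys → y ∈ₗ x ∷ xs → y ∈ₗ xs
    drop-x y∈ys (here refl) = ⊥-elim (All.lookup x∉ys y∈ys refl)
    drop-x _    (there y∈xs) = y∈xs

  canon-id : ∀ {xs} → xs ∈ₗ sublists (allSubsets m) → canon xs ≡ xs
  canon-id xs∈ = filter-members (unique-allSubsets m) (∈-sublists⇒⊑ (allSubsets m) xs∈)

  canon-enumerated : ∀ xs → canon xs ∈ₗ sublists (allSubsets m)
  canon-enumerated xs = ⊑⇒∈-sublists (SublistP.filter-⊆ (_∈? xs) (allSubsets m))

[]∈L : ∀ m d → [] ∈ₗ L m d
[]∈L m d = ∈-filter⁺ (isL? d) (⊑⇒∈-sublists {xs = allSubsets m} (Sublist.minimum _)) ((λ ()) ∷ [] , [])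

ρ-nonneg : ∀ {n} d (xs : Coll n) → All (λ X → ∣ X ∣ ℕ.≤ d) xs → + 0 ℤ.≤ ρ d xs
ρ-nonneg d []       _                  = ℤP.≤-refl
ρ-nonneg d (x ∷ xs) (∣x∣≤d ∷ small)    = ℤP.+-mono-≤ (ℤP.<⇒≤ (codim-pos d x ∣x∣≤d)) (ρ-nonneg d xs small)

∅≤ : ∀ {n} d (T : Coll n) → All (λ X → ∣ X ∣ ℕ.≤ d) T → [] ≤[ d ] T
∅≤ d []       _                     = inj₂ refl
∅≤ d (x ∷ xs) small@(∣x∣≤d ∷ small′) = inj₁ (ρ>0 , [])
  where
  ρ>0 : + 0 ℤ.< ρ d (x ∷ xs)
  ρ>0 = ℤP.<-≤-trans (codim-pos d x ∣x∣≤d)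
          (subst (ℤ._≤ codim d x + ρ d xs) (ℤP.+-identityʳ (codim d x))
                 (ℤP.+-monoʳ-≤ (codim d x) (ρ-nonneg d xs small′)))

module OneWay (u d d′ : ℕ) (ps : List (Pair (d ℕ.+ u) (d′ ℕ.+ u)))
  (codim≡ : All (λ p → codim d (proj₁ p) ≡ codim d′ (proj₂ p)) ps)
  {T : Coll (d ℕ.+ u)} {T′ : Coll (d′ ℕ.+ u)}
  (T∈L : T ∈ₗ L (d ℕ.+ u) d) (T′∈L : T′ ∈ₗ L (d′ ℕ.+ u) d′)
  (Xs↭T : map proj₁ ps ↭ T) (Ys↭T′ : map proj₂ ps ↭ T′) where

  private
    n n′ : ℕ
    n  = d ℕ.+ u
    n′ = d′ ℕ.+ u

  ∣∁∣≡ : All (λ p → ∣ ∁ (proj₁ p) ∣ ≡ ∣ ∁ (proj₂ p) ∣) ps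
  ∣∁∣≡ = All.map (λ {p} → codim≡⇒∣∁∣≡ d d′ u (proj₁ p) (proj₂ p)) codim≡

  open Gluing d d′ ps ∣∁∣≡ codim≡ (positive-↭ Xs↭T (proj₂ (L⁻ T∈L))) (positive-↭ Ys↭T′ (proj₂ (L⁻ T′∈L)))
  open Canonical n using (canon; canon-cong; canon-id)
  open Canonical n′ using () renaming (canon to canon′; canon-∈⁻ to canon′-∈⁻; canon-∈⁺ to canon′-∈⁺;
    canon-↭ to canon′-↭; canon-cong to canon′-cong; canon-id to canon′-id; canon-enumerated to canon′-enumerated)

  τ : Subset n′ → Subset n
  τ = glue (map swap ps)

  τ-σ : ∀ {Z} → SmallOver d Xs Z → τ (σ Z) ≡ Z
  τ-σ {Z} over = begin
    τ (σ Z)                ≡⟨ cong τ σ≡ ⟩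
    τ (transplant X Y Z)   ≡⟨ glue-agrees (map swap ps) unique-swapped (∈-map⁺ swap pair∈) (⊆-transplant Z) ⟩
    transplant Y X (transplant X Y Z) ≡⟨ transplant-inverse (All.lookup ∣∁∣≡ pair∈) Z X⊆Z ⟩
    Z                      ∎
    where
    open ≡-Reasoning
    open Generator (generator over)
    X = proj₁ pair
    Y = proj₂ pair
    open Transplant X Y
    ∣σZ∣≤d′ : ∣ transplant X Y Z ∣ ℕ.≤ d′
    ∣σZ∣≤d′ = subst (λ W → ∣ W ∣ ℕ.≤ d′) σ≡ (proj₁ (σ-SmallOver over))
    unique-swapped : ∀ {p q} → p ∈ₗ map swap ps → q ∈ₗ map swap ps →
                     proj₁ p ⊆ transplant X Y Z → proj₁ q ⊆ transplant X Y Z → p ≡ q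
    unique-swapped p∈ q∈ p⊆ q⊆ with ∈-map⁻ swap p∈ | ∈-map⁻ swap q∈
    ... | _ , p₀∈ , refl | _ , q₀∈ , refl = cong swap (unique-Y ∣σZ∣≤d′ p₀∈ q₀∈ p⊆ q⊆)

  to : Coll n → Coll n′
  to S = canon′ (map σ S)

  from : Coll n′ → Coll n
  from S = canon (map τ S)

  small-T : All (λ X → ∣ X ∣ ℕ.≤ d) T
  small-T = proj₂ (proj₂ (L⁻ T∈L))

  below⇒over : ∀ {S} → Below n d T S → All (SmallOver d Xs) S
  below⇒over {S} (S∈L , S≤T) = All.tabulate (λ Z∈ → All.lookup (proj₂ (proj₂ (L⁻ S∈L))) Z∈ , over-T S≤T Z∈)
    where
    over-T : S ≤[ d ] T → ∀ {Z} → Z ∈ₗ S → Any (λ X → X ⊆ Z) Xs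
    over-T (inj₂ refl)       Z∈ = ListMem.lose (PermP.∈-resp-↭ (↭-sym Xs↭T) Z∈) id
    over-T (inj₁ (_ , cov)) Z∈ = PermP.Any-resp-↭ (↭-sym Xs↭T) (All.lookup cov Z∈)

  to-↭ : ∀ {S} → Below n d T S → to S ↭ map σ S
  to-↭ S≤@(S∈L , _) = canon′-↭ (unique-map σ (SmallOver d Xs) σ-injective (below⇒over S≤) unique-S)
    where
    σ-injective : ∀ {A B} → SmallOver d Xs A → SmallOver d Xs B → σ A ≡ σ B → A ≡ B
    σ-injective overA overB σA≡σB = trans (sym (τ-σ overA)) (trans (cong τ σA≡σB) (τ-σ overB))
    unique-S : Unique _
    unique-S = unique-⊑ (unique-allSubsets n) (∈-sublists⇒⊑ (allSubsets n) (proj₁ (L⁻ S∈L)))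

  to-L : ∀ {S} → Below n d T S → to S ∈ₗ L n′ d′
  to-L {S} S≤ = ∈-filter⁺ (isL? d′) (canon′-enumerated (map σ S))
    (IsL-↭ d′ (↭-sym (to-↭ S≤)) (IsL-σ (proj₂ (L⁻ (proj₁ S≤))) (below⇒over S≤)))

  ρ-to : ∀ {S} → Below n d T S → ρ d′ (to S) ≡ ρ d S
  ρ-to {S} S≤ = trans (ρ-↭ d′ (to-↭ S≤)) (ρ-σ (below⇒over S≤))
    where
    ρ-σ : ∀ {R} → All (SmallOver d Xs) R → ρ d′ (map σ R) ≡ ρ d R
    ρ-σ []             = refl
    ρ-σ (over ∷ overs) = cong₂ _+_ (codim-σ over) (ρ-σ overs)

  to-< : ∀ {S₁ S₂} → Below n d T S₁ → Below n d T S₂ → S₁ <[ d ] S₂ → to S₁ <[ d′ ] to S₂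
  to-< {S₁} {S₂} S₁≤ S₂≤ (ρ< , cov) = subst₂ ℤ._<_ (sym (ρ-to S₁≤)) (sym (ρ-to S₂≤)) ρ< , All.tabulate covered
    where
    covered : ∀ {A′} → A′ ∈ₗ to S₁ → Any (λ B′ → B′ ⊆ A′) (to S₂)
    covered A′∈ with ∈-map⁻ σ (canon′-∈⁻ A′∈)
    ... | A , A∈ , refl with ListMem.find (All.lookup cov A∈)
    ...   | B , B∈ , B⊆A = ListMem.lose (canon′-∈⁺ (∈-map⁺ σ B∈))
                             (σ-mono (All.lookup (below⇒over S₁≤) A∈) (All.lookup (below⇒over S₂≤) B∈) B⊆A)

  σ-X : ∀ {p} → p ∈ₗ ps → σ (proj₁ p) ≡ proj₂ p
  σ-X {p} p∈ = trans (glue-agrees ps (unique-X ∣X∣≤d) p∈ id) (Transplant.transplant-self (proj₁ p) (proj₂ p))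
    where
    ∣X∣≤d : ∣ proj₁ p ∣ ℕ.≤ d
    ∣X∣≤d = All.lookup small-T (PermP.∈-resp-↭ Xs↭T (∈-map⁺ proj₁ p∈))

  to-top : to T ≡ T′
  to-top = trans (canon′-cong (PermP.∈-resp-↭ σT↭T′) (PermP.∈-resp-↭ (↭-sym σT↭T′))) (canon′-id (proj₁ (L⁻ T′∈L)))
    where
    σXs≡Ys : map σ Xs ≡ Ys
    σXs≡Ys = trans (sym (ListP.map-∘ ps)) (ListP.map-cong-local (All.tabulate σ-X))
    σT↭T′ : map σ T ↭ T′
    σT↭T′ = ↭-trans (PermP.map⁺ σ (↭-sym Xs↭T)) (subst (_↭ T′) (sym σXs≡Ys) Ys↭T′)

  ∅-below : Below n d T []
  ∅-below = []∈L n d , ∅≤ d T small-T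

  to-below : ∀ {S} → Below n d T S → Below n′ d′ T′ (to S)
  to-below S≤@(_ , inj₂ refl) = to-L S≤ , inj₂ to-top
  to-below S≤@(_ , inj₁ S<T)  = to-L S≤ , inj₁ (subst (to _ <[ d′ ]_) to-top (to-< S≤ (T∈L , inj₂ refl) S<T))

  from-to : ∀ {S} → Below n d T S → from (to S) ≡ S
  from-to {S} S≤ = trans (canon-cong image⊆ image⊇) (canon-id (proj₁ (L⁻ (proj₁ S≤))))
    where
    image⊆ : ∀ {Z} → Z ∈ₗ map τ (to S) → Z ∈ₗ S
    image⊆ Z∈ with ∈-map⁻ τ Z∈
    ... | W , W∈ , refl with ∈-map⁻ σ (canon′-∈⁻ W∈)
    ...   | V , V∈ , refl = subst (_∈ₗ S) (sym (τ-σ (All.lookup (below⇒over S≤) V∈))) V∈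
    image⊇ : ∀ {Z} → Z ∈ₗ S → Z ∈ₗ map τ (to S)
    image⊇ Z∈ = subst (_∈ₗ map τ (to S)) (τ-σ (All.lookup (below⇒over S≤) Z∈))
                      (∈-map⁺ τ (canon′-∈⁺ (∈-map⁺ σ Z∈)))

  to-∅ : to [] ≡ []
  to-∅ = canon′-id (⊑⇒∈-sublists {xs = allSubsets n′} (Sublist.minimum _))

paired-interval-iso : ∀ u d d′ (ps : List (Pair (d ℕ.+ u) (d′ ℕ.+ u))) →
  All (λ p → codim d (proj₁ p) ≡ codim d′ (proj₂ p)) ps →
  ∀ {T T′} → T ∈ₗ L (d ℕ.+ u) d → T′ ∈ₗ L (d′ ℕ.+ u) d′ →
  map proj₁ ps ↭ T → map proj₂ ps ↭ T′ → IntervalIso (d ℕ.+ u) d (d′ ℕ.+ u) d′ T T′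
paired-interval-iso u d d′ ps codim≡ T∈L T′∈L Xs↭T Ys↭T′ = record
  { to         = F.to
  ; from       = B.to
  ; to-below   = F.to-below
  ; from-below = B.to-below
  ; from-to    = F.from-to
  ; to-from    = λ {S} S≤ → trans (cong (λ qs → Canonical.canon (d′ ℕ.+ u) (map (glue qs) (B.to S))) (sym swap-swap))
                                  (B.from-to S≤)
  ; to-<       = F.to-<
  ; from-<     = B.to-<
  ; top∈L      = T∈L
  ; ∅-below    = F.∅-below
  ; to-∅       = F.to-∅
  ; to-top     = F.to-top
  }
  where
  swap-swap : map swap (map swap ps) ≡ ps
  swap-swap = trans (sym (ListP.map-∘ ps)) (ListP.map-id ps)
  module F = OneWay u d d′ ps codim≡ T∈L T′∈L Xs↭T Ys↭T′
  module B = OneWay u d′ d (map swap ps) (AllP.map⁺ (All.map sym codim≡)) T′∈L T∈L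
               (subst (_↭ _) (ListP.map-∘ ps) Ys↭T′) (subst (_↭ _) (ListP.map-∘ ps) Xs↭T)

pointwise⇒pairs : ∀ {A B : Set} {R : A → B → Set} {xs ys} → Pointwise R xs ys →
  Σ (List (A × B)) (λ ps → map proj₁ ps ≡ xs × map proj₂ ps ≡ ys × All (λ p → R (proj₁ p) (proj₂ p)) ps)
pointwise⇒pairs []                 = [] , refl , refl , []
pointwise⇒pairs (_∷_ {x} {y} r rs) with pointwise⇒pairs rs
... | ps , refl , refl , rs′ = (x , y) ∷ ps , refl , refl , r ∷ rs′

corollary4p3 : (u d d′ : ℕ) → 1 ℕ.≤ u → 1 ℕ.≤ d → 1 ℕ.≤ d′ →
    (T : Coll (d ℕ.+ u)) (T′ : Coll (d′ ℕ.+ u)) →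
    T ∈ₗ L (d ℕ.+ u) d → T′ ∈ₗ L (d′ ℕ.+ u) d′ →
    (ts : List (Subset (d ℕ.+ u))) (ts′ : List (Subset (d′ ℕ.+ u))) →
    ts ↭ T → ts′ ↭ T′ →
    Pointwise (λ X Y → codim d X ≡ codim d′ Y) ts ts′ →
    μ̄ u d T ≡ μ̄ u d′ T′
corollary4p3 u d d′ _ _ _ T T′ T∈L T′∈L ts ts′ ts↭T ts′↭T′ codims with pointwise⇒pairs codims
... | ps , refl , refl , codim≡ = μ-iso (paired-interval-iso u d d′ ps codim≡ T∈L T′∈L ts↭T ts′↭T′)
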